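{- Let $n\ge 3$ be an integer and let $I$ be a degree-based topological index with coefficients $c_{12},c_{13},c_{22},c_{23},c_{33}\in\mathbb{R}$. Define $c'_{12}=c_{12}-4c_{22}+3c_{23}$, $c'_{13}=c_{13}-3c_{22}+2c_{23}$, $c'_{33}=c_{22}-2c_{23}+c_{33}$. If $\max\{0,-c'_{33}\}<\min\{c'_{12},c'_{13}\}$, then the cycle $C_n$ on $n$ vertices is the only graph in $\mathcal{G}_3(n,n)$ that minimizes $I$.
   Context: For integers $n,m$, $\mathcal{G}_3(n,m)$ denotes the set of simple connected undirected graphs with $n$ vertices, $m$ edges and maximum degree at most $3$ (chemical graphs); thus $\mathcal{G}_3(n,n)$ is the set of connected unicyclic graphs on $n$ vertices with maximum degree at most $3$. For a graph $G$ and $1\le i\le j$, an $ij$-edge is an edge whose endpoints have degrees $i$ and $j$, and $m_{ij}$ is the number of $ij$-edges of $G$. A degree-based topological index $I$ with coefficients $c_{ij}$ assigns to $G\in\mathcal{G}_3(n,m)$, $n\ge 3$, the value $I(G)=c_{12}m_{12}+c_{13}m_{13}+c_{22}m_{22}+c_{23}m_{23}+c_{33}m_{33}$. Graphs are considered up to isomorphism. -}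

module Defs where

open import Level using (Level; _⊔_) renaming (suc to lsuc)
open import Data.Bool using (Bool; true; false; _∧_; _∨_; T)
open import Data.Nat as ℕ using (ℕ; zero; suc; _≡ᵇ_; _<ᵇ_; _%_)
open import Data.Fin using (Fin; toℕ)
open import Data.List using (List; length; filterᵇ; allFin; concatMap; map)
open import Data.Product using (_×_; _,_; Σ; ∃)
open import Relation.Binary.PropositionalEquality using (_≡_)
open import Relation.Binary.Structures using (IsStrictTotalOrder)
open import Relation.Binary.Core using (Rel)
open import Function.Bundles using (_↔_; Inverse)
open import Algebra.Bundles using (AbelianGroup)

-- The real numbers with + and < are an instance; the index is an
-- integer-linear combination of the coefficients, so only this
-- structure is used.

record OrderedAbelianGroup (c ℓ₁ ℓ₂ : Level) : Set (lsuc (c ⊔ ℓ₁ ⊔ ℓ₂)) where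
  field
    abelianGroup : AbelianGroup c ℓ₁
  open AbelianGroup abelianGroup public
  infix 4 _<_
  field
    _<_                : Rel Carrier ℓ₂
    isStrictTotalOrder : IsStrictTotalOrder _≈_ _<_
    +-monoˡ-<          : ∀ {x y} z → x < y → (x ∙ z) < (y ∙ z)

  infixr 8 _·_
  _·_ : ℕ → Carrier → Carrier
  zero  · x = ε
  suc k · x = x ∙ (k · x)

Graph : ℕ → Set
Graph n = Fin n → Fin n → Bool

module _ {n : ℕ} (G : Graph n) where

  IsSimple : Set
  IsSimple = (∀ u v → G u v ≡ G v u) × (∀ u → G u u ≡ false)

  deg : Fin n → ℕ
  deg u = length (filterᵇ (G u) (allFin n))

  edges : List (Fin n × Fin n)
  edges = concatMap (λ u → map (u ,_)
            (filterᵇ (λ v → (toℕ u <ᵇ toℕ v) ∧ G u v) (allFin n))) (allFin n)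

  numEdges : ℕ
  numEdges = length edges

  data Reachable : Fin n → Fin n → Set where
    here : ∀ {u} → Reachable u u
    step : ∀ {u v w} → T (G u v) → Reachable v w → Reachable u w

  Connected : Set
  Connected = ∀ u v → Reachable u v

  MaxDegree≤3 : Set
  MaxDegree≤3 = ∀ u → deg u ℕ.≤ 3

  m : ℕ → ℕ → ℕ
  m i j = length (filterᵇ (λ { (u , v) →
            ((deg u ≡ᵇ i) ∧ (deg v ≡ᵇ j)) ∨ ((deg u ≡ᵇ j) ∧ (deg v ≡ᵇ i)) })
            edges)

𝒢₃ : (n e : ℕ) → Graph n → Set
𝒢₃ n e G = IsSimple G × Connected G × MaxDegree≤3 G × numEdges G ≡ e

_≅_ : ∀ {n} → Graph n → Graph n → Set
_≅_ {n} G H = Σ (Fin n ↔ Fin n) λ f →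
  ∀ u v → G u v ≡ H (Inverse.to f u) (Inverse.to f v)

cycle : (k : ℕ) → Graph (3 ℕ.+ k)
cycle k u v = (toℕ v ≡ᵇ (suc (toℕ u) % (3 ℕ.+ k)))
            ∨ (toℕ u ≡ᵇ (suc (toℕ v) % (3 ℕ.+ k)))

module Index {c ℓ₁ ℓ₂} (O : OrderedAbelianGroup c ℓ₁ ℓ₂) where
  open OrderedAbelianGroup O

  I : (c12 c13 c22 c23 c33 : Carrier) → ∀ {n} → Graph n → Carrier
  I c12 c13 c22 c23 c33 G =
    (m G 1 2 · c12) ∙ ((m G 1 3 · c13) ∙ ((m G 2 2 · c22) ∙
      ((m G 2 3 · c23) ∙ (m G 3 3 · c33))))

  c'12 : (c12 c22 c23 : Carrier) → Carrier
  c'12 c12 c22 c23 = (c12 ∙ (3 · c23)) ∙ ((4 · c22) ⁻¹)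

  c'13 : (c13 c22 c23 : Carrier) → Carrier
  c'13 c13 c22 c23 = (c13 ∙ (2 · c23)) ∙ ((3 · c22) ⁻¹)

  c'33 : (c22 c23 c33 : Carrier) → Carrier
  c'33 c22 c23 c33 = (c22 ∙ c33) ∙ ((2 · c23) ⁻¹)

  -- max{0, -x} < min{y, z}, unfolded
  MaxMin< : (x y z : Carrier) → Set ℓ₂
  MaxMin< x y z = (ε < y) × (ε < z) × ((x ⁻¹) < y) × ((x ⁻¹) < z)

-- Counting edge ends by degree gives m₁₂ + m₁₃ = n₁, m₁₂ + 2m₂₂ + m₂₃ = 2n₂ and
-- m₁₃ + m₂₃ + 2m₃₃ = 3n₃.  In a unicyclic graph the numbers of edges and vertices agree,
-- which forces n₃ = n₁ and lets one eliminate m₂₂ and m₂₃: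
--   I(G) = n c₂₂ + m₁₂ c′₁₂ + m₁₃ c′₁₃ + m₃₃ c′₃₃.
-- In a breadth-first spanning tree rooted at a vertex of degree 3, charge each edge joining
-- two vertices of degree 3 to its end farther from the root; only the single non-tree edge
-- may stay uncharged, so m₃₃ ≤ n₃ = m₁₂ + m₁₃.  The hypothesis then makes the excess over
-- n c₂₂ positive as soon as G has a pendant vertex.  Without pendant vertices n₃ = n₁ = 0,
-- so G is connected and 2-regular, i.e. a cycle, and I(Cₙ) = n c₂₂.

module Submission where

open import Defs
open import Level using (Level)
open import Data.Nat using (ℕ; _+_)
open import Data.Product using (_×_; _,_)
open import Relation.Nullary using (¬_)
open import Relation.Binary.PropositionalEquality using (refl)

module Chemical-Graphs where

  open import Data.Bool using (Bool; true; false; T; not; _∧_; _∨_)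
  open import Data.Bool.Properties using (∧-zeroʳ; ∨-idem; ∨-comm; T-∧; T-∨)
  open import Data.Empty using (⊥; ⊥-elim)
  open import Data.Fin using (Fin; zero; suc; toℕ; fromℕ; fromℕ<; _≟_)
  open import Data.Fin.Properties
    using (toℕ-injective; any?; toℕ<n; toℕ-fromℕ<; toℕ-fromℕ; fromℕ<-toℕ; pigeonhole; injective⇒≤)
  open import Data.List using (List; []; _∷_; _++_; length; filterᵇ; map; concatMap; tabulate; allFin)
  open import Data.List.Properties using (length-++; filter-++)
  open import Data.Nat using (ℕ; zero; suc; pred; >-nonZero; _+_; _*_; _∸_; _≤_; _<_; z≤n; s≤s; _≡ᵇ_; _<ᵇ_; _%_)
  open import Data.Nat.DivMod using (m%n<n; m<n⇒m%n≡m; n%n≡0)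
  open import Data.Nat.Properties
    using (*-cancelˡ-≡; *-comm; *-commutativeSemigroup; *-distribʳ-+; *-distribˡ-+; *-identityʳ; *-identityˡ;
           *-mono-≤; *-monoʳ-≤; *-monoˡ-≤; *-zeroʳ; +-*-semiring; +-cancelʳ-≤; +-cancelˡ-≡; +-identityʳ;
           +-mono-≤; +-monoˡ-≤; 0≢1+n; 1+n≢0; 1+n≢n; 1+n≰n; <-asym; <-cmp; <-trans; <ᵇ⇒<; <⇒<ᵇ; <⇒≢;
           m+n≡0⇒m≡0; m+n≡0⇒n≡0; m∸n+n≡m; m≢1+n+m; m≤m+n; m≤n+m; m≤n⇒m<n∨m≡n; n<1+n; suc-injective;
           suc-pred; ≡ᵇ⇒≡; ≡⇒≡ᵇ; ≤-antisym; ≤-pred; ≤-refl; ≤-reflexive; ≤-trans; ≮⇒≥; module ≤-Reasoning)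
  open import Data.Nat.Tactic.RingSolver using (solve-∀)
  open import Data.Product using (∃; _×_; _,_; proj₁; proj₂)
  open import Data.Sum using (_⊎_; inj₁; inj₂; [_,_])
  open import Function using (_∘_; id)
  open import Function.Bundles using (Equivalence; mk↔ₛ′)
  open import Relation.Binary.Definitions using (tri<; tri≈; tri>)
  open import Relation.Binary.PropositionalEquality
    using (_≡_; refl; sym; trans; cong; cong₂; subst; subst₂; module ≡-Reasoning)
  open import Relation.Binary.Structures using (IsStrictTotalOrder)
  open import Relation.Nullary using (¬_; yes; no; does)
  open import Relation.Nullary.Decidable
    using (T?; ¬?; _×-dec_; ⌊_⌋; toWitness; fromWitness; dec-true; dec-false)
  open import Algebra.Properties.CommutativeSemigroup *-commutativeSemigroup using (x∙yz≈y∙xz)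
  open import Algebra.Properties.Semiring.Sum +-*-semiring
    using (sum; sum-syntax; ∑-distrib-+; ∑-comm; *-distribˡ-sum; sum-cong-≗; sum-replicate-zero)

  𝟙 : Bool → ℕ
  𝟙 true  = 1
  𝟙 false = 0

  𝟙≤1 : ∀ b → 𝟙 b ≤ 1
  𝟙≤1 true  = s≤s z≤n
  𝟙≤1 false = z≤n

  T⇒≡true : ∀ {b} → T b → b ≡ true
  T⇒≡true {true} _ = refl

  ¬T⇒≡false : ∀ {b} → ¬ T b → b ≡ false
  ¬T⇒≡false {true}  ¬t = ⊥-elim (¬t _)
  ¬T⇒≡false {false} _  = refl

  𝟙-T : ∀ {b} → T b → 𝟙 b ≡ 1
  𝟙-T {true} _ = refl

  𝟙-∧ : ∀ a b → 𝟙 (a ∧ b) ≡ 𝟙 a * 𝟙 b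
  𝟙-∧ true  b = sym (+-identityʳ (𝟙 b))
  𝟙-∧ false b = refl

  sum-mono-≤ : ∀ {n} {f g : Fin n → ℕ} → (∀ i → f i ≤ g i) → sum f ≤ sum g
  sum-mono-≤ {zero}  f≤g = z≤n
  sum-mono-≤ {suc n} f≤g = +-mono-≤ (f≤g zero) (sum-mono-≤ (f≤g ∘ suc))

  ∑-1≡n : ∀ n → ∑[ i < n ] 1 ≡ n
  ∑-1≡n zero    = refl
  ∑-1≡n (suc n) = cong suc (∑-1≡n n)

  term≤sum : ∀ {n} (f : Fin n → ℕ) i → f i ≤ sum f
  term≤sum f zero    = m≤m+n _ _
  term≤sum f (suc i) = ≤-trans (term≤sum (f ∘ suc) i) (m≤n+m _ _)

  δ : ∀ {n} → Fin n → Fin n → ℕ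
  δ i j = 𝟙 (does (i ≟ j))

  ∑-δ : ∀ {n} (w : Fin n) (f : Fin n → ℕ) → ∑[ i < n ] (δ i w * f i) ≡ f w
  ∑-δ {suc n} zero    f = trans (cong (f zero + 0 +_) (sum-replicate-zero n))
                                (trans (+-identityʳ _) (+-identityʳ _))
  ∑-δ {suc n} (suc w) f = ∑-δ w (f ∘ suc)

  ∑-δ≡1 : ∀ {n} (w : Fin n) → ∑[ i < n ] δ i w ≡ 1
  ∑-δ≡1 {n} w = trans (sum-cong-≗ (λ i → sym (*-identityʳ (δ i w)))) (∑-δ w (λ _ → 1))

  0<sum⇒0<term : ∀ {n} (f : Fin n → ℕ) → 0 < sum f → ∃ λ i → 0 < f i
  0<sum⇒0<term {suc n} f 0<∑ with f zero in eq
  ... | suc _ = zero , subst (0 <_) (sym eq) (s≤s z≤n)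
  ... | zero  with 0<sum⇒0<term (f ∘ suc) 0<∑
  ...   | i , 0<fi = suc i , 0<fi

  module _ {A : Set} where

    length-filterᵇ-tabulate : ∀ {n} (p : A → Bool) (f : Fin n → A) →
      length (filterᵇ p (tabulate f)) ≡ ∑[ i < n ] 𝟙 (p (f i))
    length-filterᵇ-tabulate {zero}  p f = refl
    length-filterᵇ-tabulate {suc n} p f with p (f zero)
    ... | true  = cong suc (length-filterᵇ-tabulate p (f ∘ suc))
    ... | false = length-filterᵇ-tabulate p (f ∘ suc)

    length-filterᵇ-concatMap : ∀ {B : Set} {n} (p : B → Bool) (g : A → List B) (f : Fin n → A) →
      length (filterᵇ p (concatMap g (tabulate f))) ≡ ∑[ i < n ] length (filterᵇ p (g (f i)))
    length-filterᵇ-concatMap {n = zero}  p g f = refl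
    length-filterᵇ-concatMap {n = suc n} p g f = begin
      length (filterᵇ p (g (f zero) ++ rest))                   ≡⟨ cong length (filter-++ (T? ∘ p) (g (f zero)) rest) ⟩
      length (filterᵇ p (g (f zero)) ++ filterᵇ p rest)         ≡⟨ length-++ (filterᵇ p (g (f zero))) ⟩
      length (filterᵇ p (g (f zero))) + length (filterᵇ p rest) ≡⟨ cong (length (filterᵇ p (g (f zero))) +_)
                                                                      (length-filterᵇ-concatMap p g (f ∘ suc)) ⟩
      length (filterᵇ p (g (f zero))) + ∑[ i < n ] length (filterᵇ p (g (f (suc i)))) ∎
      where
      open ≡-Reasoning
      rest = concatMap g (tabulate (f ∘ suc))

    length-filterᵇ-map-filterᵇ : ∀ {B : Set} {n} (p : B → Bool) (h : A → B) (q : A → Bool) (f : Fin n → A) →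
      length (filterᵇ p (map h (filterᵇ q (tabulate f)))) ≡ ∑[ i < n ] 𝟙 (q (f i) ∧ p (h (f i)))
    length-filterᵇ-map-filterᵇ {n = zero}  p h q f = refl
    length-filterᵇ-map-filterᵇ {n = suc n} p h q f with q (f zero)
    ... | false = length-filterᵇ-map-filterᵇ p h q (f ∘ suc)
    ... | true  with p (h (f zero))
    ...   | true  = cong suc (length-filterᵇ-map-filterᵇ p h q (f ∘ suc))
    ...   | false = length-filterᵇ-map-filterᵇ p h q (f ∘ suc)

  hasType : ℕ → ℕ → ℕ → ℕ → Bool
  hasType i j a b = ((a ≡ᵇ i) ∧ (b ≡ᵇ j)) ∨ ((a ≡ᵇ j) ∧ (b ≡ᵇ i))

  module Graph-Sums {n : ℕ} (G : Graph n) where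

    edgeᵇ : Fin n → Fin n → Bool
    edgeᵇ u v = (toℕ u <ᵇ toℕ v) ∧ G u v

    ∑ₑ : (Fin n → Fin n → ℕ) → ℕ
    ∑ₑ f = ∑[ u < n ] ∑[ v < n ] (𝟙 (edgeᵇ u v) * f u v)

    n[_] : ℕ → ℕ
    n[ i ] = ∑[ u < n ] 𝟙 (deg G u ≡ᵇ i)

    deg≡∑ : ∀ u → deg G u ≡ ∑[ v < n ] 𝟙 (G u v)
    deg≡∑ u = length-filterᵇ-tabulate (G u) id

    length-filterᵇ-edges : ∀ p → length (filterᵇ p (edges G)) ≡ ∑ₑ (λ u v → 𝟙 (p (u , v)))
    length-filterᵇ-edges p =
      trans (length-filterᵇ-concatMap p (λ u → map (u ,_) (filterᵇ (edgeᵇ u) (allFin n))) id)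
            (sum-cong-≗ λ u → trans (length-filterᵇ-map-filterᵇ p (u ,_) (edgeᵇ u) id)
                                    (sum-cong-≗ λ v → 𝟙-∧ (edgeᵇ u v) (p (u , v))))

    numEdges≡∑ₑ1 : numEdges G ≡ ∑ₑ (λ _ _ → 1)
    numEdges≡∑ₑ1 = trans (sym (length-filterᵇ-true (edges G))) (length-filterᵇ-edges (λ _ → true))
      where
      length-filterᵇ-true : ∀ {A : Set} (xs : List A) → length (filterᵇ (λ _ → true) xs) ≡ length xs
      length-filterᵇ-true []       = refl
      length-filterᵇ-true (x ∷ xs) = cong suc (length-filterᵇ-true xs)

    m≡∑ₑ : ∀ i j → m G i j ≡ ∑ₑ (λ u v → 𝟙 (hasType i j (deg G u) (deg G v)))
    m≡∑ₑ i j = length-filterᵇ-edges _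

    𝟙-edgeᵇ-* : ∀ u v {x y} → (T (G u v) → x ≡ y) → 𝟙 (edgeᵇ u v) * x ≡ 𝟙 (edgeᵇ u v) * y
    𝟙-edgeᵇ-* u v x≡y with toℕ u <ᵇ toℕ v | G u v
    ... | true  | true  = cong (_+ 0) (x≡y _)
    ... | true  | false = refl
    ... | false | _     = refl

    ∑ₑ-cong : ∀ {f g} → (∀ u v → T (G u v) → f u v ≡ g u v) → ∑ₑ f ≡ ∑ₑ g
    ∑ₑ-cong f≡g = sum-cong-≗ λ u → sum-cong-≗ λ v → 𝟙-edgeᵇ-* u v (f≡g u v)

    ∑ₑ-mono-≤ : ∀ {f g} → (∀ u v → f u v ≤ g u v) → ∑ₑ f ≤ ∑ₑ g
    ∑ₑ-mono-≤ f≤g = sum-mono-≤ λ u → sum-mono-≤ λ v → *-monoʳ-≤ (𝟙 (edgeᵇ u v)) (f≤g u v)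

    ∑ₑ-+ : (f g : Fin n → Fin n → ℕ) → ∑ₑ (λ u v → f u v + g u v) ≡ ∑ₑ f + ∑ₑ g
    ∑ₑ-+ f g = trans (sum-cong-≗ λ u → trans (sum-cong-≗ λ v → *-distribˡ-+ (𝟙 (edgeᵇ u v)) (f u v) (g u v))
                                            (∑-distrib-+ (e f u) (e g u)))
                     (∑-distrib-+ (sum ∘ e f) (sum ∘ e g))
      where
      e : (Fin n → Fin n → ℕ) → Fin n → Fin n → ℕ
      e h u v = 𝟙 (edgeᵇ u v) * h u v

    ∑ₑ-*ˡ : ∀ c (f : Fin n → Fin n → ℕ) → ∑ₑ (λ u v → c * f u v) ≡ c * ∑ₑ f
    ∑ₑ-*ˡ c f = sym (trans (*-distribˡ-sum c (λ u → ∑[ v < n ] (𝟙 (edgeᵇ u v) * f u v)))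
                     (sum-cong-≗ λ u → trans (*-distribˡ-sum c (λ v → 𝟙 (edgeᵇ u v) * f u v))
                                             (sum-cong-≗ λ v → x∙yz≈y∙xz c (𝟙 (edgeᵇ u v)) (f u v))))

    regular⇒m≡0 : ∀ {d i j} → (∀ u → deg G u ≡ d) → hasType i j d d ≡ false → m G i j ≡ 0
    regular⇒m≡0 {d} {i} {j} regular other-type =
      trans (m≡∑ₑ i j) (trans (∑ₑ-cong λ u v _ → cong 𝟙 (trans (cong₂ (hasType i j) (regular u) (regular v)) other-type))
                              (∑ₑ-*ˡ 0 (λ _ _ → 0)))

    reachable-trans : ∀ {x y z} → Reachable G x y → Reachable G y z → Reachable G x z
    reachable-trans here       w′ = w′
    reachable-trans (step g w) w′ = step g (reachable-trans w w′)

    reachable-closed : (S : Fin n → Set) → (∀ {x y} → S x → T (G x y) → S y) →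
                       ∀ {x y} → Reachable G x y → S x → S y
    reachable-closed S closed here       Sx = Sx
    reachable-closed S closed (step g r) Sx = reachable-closed S closed r (closed Sx g)

  module Simple-Graph {n : ℕ} (G : Graph n) (simple : IsSimple G) where

    open Graph-Sums G

    G-sym : ∀ u v → G u v ≡ G v u
    G-sym = proj₁ simple

    G-irrefl : ∀ u → G u u ≡ false
    G-irrefl = proj₂ simple

    𝟙-adj≡ : ∀ u v → 𝟙 (G u v) ≡ 𝟙 (edgeᵇ u v) + 𝟙 (edgeᵇ v u)
    𝟙-adj≡ u v with <-cmp (toℕ u) (toℕ v)
    ... | tri< u<v _ v≮u rewrite T⇒≡true (<⇒<ᵇ u<v) | ¬T⇒≡false (v≮u ∘ <ᵇ⇒< _ _) = sym (+-identityʳ _)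
    ... | tri> u≮v _ v<u rewrite ¬T⇒≡false (u≮v ∘ <ᵇ⇒< _ _) | T⇒≡true (<⇒<ᵇ v<u) | G-sym u v = refl
    ... | tri≈ _ u≡v _ rewrite toℕ-injective u≡v | G-irrefl v | ∧-zeroʳ (toℕ v <ᵇ toℕ v) = refl

    ∑-adj≡∑ₑ : (f : Fin n → Fin n → ℕ) → ∑[ u < n ] ∑[ v < n ] (𝟙 (G u v) * f u v) ≡ ∑ₑ (λ u v → f u v + f v u)
    ∑-adj≡∑ₑ f = begin
      ∑[ u < n ] ∑[ v < n ] (𝟙 (G u v) * f u v)
        ≡⟨ sum-cong-≗ (λ u → sum-cong-≗ λ v → trans (cong (_* f u v) (𝟙-adj≡ u v))
                                                    (*-distribʳ-+ (f u v) (e u v) (e v u))) ⟩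
      ∑[ u < n ] ∑[ v < n ] (e u v * f u v + e v u * f u v)
        ≡⟨ sum-cong-≗ (λ u → ∑-distrib-+ (λ v → e u v * f u v) (λ v → e v u * f u v)) ⟩
      ∑[ u < n ] (∑[ v < n ] (e u v * f u v) + ∑[ v < n ] (e v u * f u v))
        ≡⟨ ∑-distrib-+ (λ u → ∑[ v < n ] (e u v * f u v)) (λ u → ∑[ v < n ] (e v u * f u v)) ⟩
      ∑ₑ f + ∑[ u < n ] ∑[ v < n ] (e v u * f u v)
        ≡⟨ cong (∑ₑ f +_) (∑-comm (λ u v → e v u * f u v)) ⟩
      ∑ₑ f + ∑ₑ (λ u v → f v u)
        ≡⟨ sym (∑ₑ-+ f (λ u v → f v u)) ⟩
      ∑ₑ (λ u v → f u v + f v u) ∎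
      where
      open ≡-Reasoning
      e : Fin n → Fin n → ℕ
      e u v = 𝟙 (edgeᵇ u v)

    handshake : (w : Fin n → ℕ) → ∑[ u < n ] (w u * deg G u) ≡ ∑ₑ (λ u v → w u + w v)
    handshake w = begin
      ∑[ u < n ] (w u * deg G u)
        ≡⟨ sum-cong-≗ (λ u → trans (cong (w u *_) (deg≡∑ u)) (*-distribˡ-sum (w u) (𝟙 ∘ G u))) ⟩
      ∑[ u < n ] ∑[ v < n ] (w u * 𝟙 (G u v))
        ≡⟨ sum-cong-≗ (λ u → sum-cong-≗ λ v → *-comm (w u) (𝟙 (G u v))) ⟩
      ∑[ u < n ] ∑[ v < n ] (𝟙 (G u v) * w u)
        ≡⟨ ∑-adj≡∑ₑ (λ u v → w u) ⟩
      ∑ₑ (λ u v → w u + w v) ∎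
      where open ≡-Reasoning

    reachable-sym : ∀ {x y} → Reachable G x y → Reachable G y x
    reachable-sym here                       = here
    reachable-sym (step {u} {v} g w) = reachable-trans (reachable-sym w) (step (subst T (G-sym u v) g) here)

    1≤deg : ∀ {u a} → T (G u a) → 1 ≤ deg G u
    1≤deg {u} {a} ga = begin
      1                      ≡⟨ sym (𝟙-T ga) ⟩
      𝟙 (G u a)              ≤⟨ term≤sum (𝟙 ∘ G u) a ⟩
      ∑[ v < n ] 𝟙 (G u v)   ≡⟨ sym (deg≡∑ u) ⟩
      deg G u                ∎
      where open ≤-Reasoning

    2≤deg : ∀ {u a b} → T (G u a) → T (G u b) → ¬ a ≡ b → 2 ≤ deg G u
    2≤deg {u} {a} {b} ga gb a≢b = subst₂ _≤_
      (trans (∑-distrib-+ (λ v → δ v a) (λ v → δ v b)) (cong₂ _+_ (∑-δ≡1 a) (∑-δ≡1 b)))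
      (sym (deg≡∑ u))
      (sum-mono-≤ δ+δ≤adj)
      where
      δ+δ≤adj : ∀ v → δ v a + δ v b ≤ 𝟙 (G u v)
      δ+δ≤adj v with v ≟ a | v ≟ b
      ... | yes refl | yes refl = ⊥-elim (a≢b refl)
      ... | yes refl | no _     = ≤-reflexive (sym (𝟙-T ga))
      ... | no _     | yes refl = ≤-reflexive (sym (𝟙-T gb))
      ... | no _     | no _     = z≤n

    3≤deg : ∀ {u a b c} → T (G u a) → T (G u b) → T (G u c) → ¬ a ≡ b → ¬ a ≡ c → ¬ b ≡ c → 3 ≤ deg G u
    3≤deg {u} {a} {b} {c} ga gb gc a≢b a≢c b≢c = subst₂ _≤_
      (trans (∑-distrib-+ (λ v → δ v a + δ v b) (λ v → δ v c))
             (cong₂ _+_ (trans (∑-distrib-+ (λ v → δ v a) (λ v → δ v b)) (cong₂ _+_ (∑-δ≡1 a) (∑-δ≡1 b)))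
                        (∑-δ≡1 c)))
      (sym (deg≡∑ u))
      (sum-mono-≤ δ+δ+δ≤adj)
      where
      δ+δ+δ≤adj : ∀ v → δ v a + δ v b + δ v c ≤ 𝟙 (G u v)
      δ+δ+δ≤adj v with v ≟ a | v ≟ b | v ≟ c
      ... | yes refl | yes refl | _        = ⊥-elim (a≢b refl)
      ... | yes refl | _        | yes refl = ⊥-elim (a≢c refl)
      ... | _        | yes refl | yes refl = ⊥-elim (b≢c refl)
      ... | yes refl | no _     | no _     = ≤-reflexive (sym (𝟙-T ga))
      ... | no _     | yes refl | no _     = ≤-reflexive (sym (𝟙-T gb))
      ... | no _     | no _     | yes refl = ≤-reflexive (sym (𝟙-T gc))
      ... | no _     | no _     | no _     = z≤n

  third-vertex : ∀ {k} (u v : Fin (3 + k)) → ∃ λ w → ¬ w ≡ u × ¬ w ≡ v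
  third-vertex u v with zero ≟ u | zero ≟ v
  ... | no 0≢u | no 0≢v = zero , 0≢u , 0≢v
  ... | yes refl | _ with suc zero ≟ v
  ...   | no 1≢v    = suc zero , (λ ()) , 1≢v
  ...   | yes refl  = suc (suc zero) , (λ ()) , (λ ())
  third-vertex u v | no 0≢u | yes refl with suc zero ≟ u
  ...   | no 1≢u    = suc zero , 1≢u , (λ ())
  ...   | yes refl  = suc (suc zero) , (λ ()) , (λ ())

  τ : ℕ → ℕ → ℕ → ℕ → ℕ
  τ i j a b = 𝟙 (hasType i j a b)

  record EndDegreeCounts (a b : ℕ) : Set where
    field
      ends₁ : 𝟙 (a ≡ᵇ 1) + 𝟙 (b ≡ᵇ 1) ≡ τ 1 2 a b + τ 1 3 a b
      ends₂ : 𝟙 (a ≡ᵇ 2) + 𝟙 (b ≡ᵇ 2) ≡ τ 1 2 a b + 2 * τ 2 2 a b + τ 2 3 a b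
      ends₃ : 𝟙 (a ≡ᵇ 3) + 𝟙 (b ≡ᵇ 3) ≡ τ 1 3 a b + τ 2 3 a b + 2 * τ 3 3 a b
      types : 1 ≡ τ 1 2 a b + τ 1 3 a b + τ 2 2 a b + τ 2 3 a b + τ 3 3 a b

  end-degree-counts : ∀ {a b} → 1 ≤ a → a ≤ 3 → 1 ≤ b → b ≤ 3 → ¬ (a ≡ 1 × b ≡ 1) → EndDegreeCounts a b
  end-degree-counts {1} {1} _ _ _ _ ¬1-1 = ⊥-elim (¬1-1 (refl , refl))
  end-degree-counts {1} {2} _ _ _ _ _ = record { ends₁ = refl ; ends₂ = refl ; ends₃ = refl ; types = refl }
  end-degree-counts {1} {3} _ _ _ _ _ = record { ends₁ = refl ; ends₂ = refl ; ends₃ = refl ; types = refl }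
  end-degree-counts {2} {1} _ _ _ _ _ = record { ends₁ = refl ; ends₂ = refl ; ends₃ = refl ; types = refl }
  end-degree-counts {2} {2} _ _ _ _ _ = record { ends₁ = refl ; ends₂ = refl ; ends₃ = refl ; types = refl }
  end-degree-counts {2} {3} _ _ _ _ _ = record { ends₁ = refl ; ends₂ = refl ; ends₃ = refl ; types = refl }
  end-degree-counts {3} {1} _ _ _ _ _ = record { ends₁ = refl ; ends₂ = refl ; ends₃ = refl ; types = refl }
  end-degree-counts {3} {2} _ _ _ _ _ = record { ends₁ = refl ; ends₂ = refl ; ends₃ = refl ; types = refl }
  end-degree-counts {3} {3} _ _ _ _ _ = record { ends₁ = refl ; ends₂ = refl ; ends₃ = refl ; types = refl }
  end-degree-counts {suc (suc (suc (suc _)))} _ (s≤s (s≤s (s≤s ()))) _ _ _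
  end-degree-counts {1} {suc (suc (suc (suc _)))} _ _ _ (s≤s (s≤s (s≤s ()))) _
  end-degree-counts {2} {suc (suc (suc (suc _)))} _ _ _ (s≤s (s≤s (s≤s ()))) _
  end-degree-counts {3} {suc (suc (suc (suc _)))} _ _ _ (s≤s (s≤s (s≤s ()))) _

  degree-classes : ∀ {a} → 1 ≤ a → a ≤ 3 → 𝟙 (a ≡ᵇ 1) + 𝟙 (a ≡ᵇ 2) + 𝟙 (a ≡ᵇ 3) ≡ 1
  degree-classes {1} _ _ = refl
  degree-classes {2} _ _ = refl
  degree-classes {3} _ _ = refl
  degree-classes {suc (suc (suc (suc _)))} _ (s≤s (s≤s (s≤s ())))

  i*𝟙[a≡ᵇi]≡𝟙[a≡ᵇi]*a : ∀ i a → i * 𝟙 (a ≡ᵇ i) ≡ 𝟙 (a ≡ᵇ i) * a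
  i*𝟙[a≡ᵇi]≡𝟙[a≡ᵇi]*a i a with a ≡ᵇ i in eq
  ... | true  rewrite ≡ᵇ⇒≡ a i (subst T (sym eq) _) = trans (*-identityʳ i) (sym (+-identityʳ i))
  ... | false = *-zeroʳ i

  record UnicyclicCounts (n m12 m13 m22 m23 m33 : ℕ) : Set where
    field
      m₂₂-relation : m22 + (m12 * 4 + m13 * 3) ≡ n + m33
      m₂₃-relation : m23 + m33 * 2 ≡ m12 * 3 + m13 * 2
      m₃₃≤m₁₂+m₁₃  : m33 ≤ m12 + m13

  module Chemical-Graph (k : ℕ) (G : Graph (3 + k)) (simple : IsSimple G)
                        (connected : Connected G) (maxdeg : MaxDegree≤3 G) where

    open Graph-Sums G
    open Simple-Graph G simple

    0<deg : ∀ u → 0 < deg G u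
    0<deg u with third-vertex u u
    ... | w , w≢u , _ with connected u w
    ...   | here     = ⊥-elim (w≢u refl)
    ...   | step g _ = 1≤deg g

    deg≡1⇒unique-neighbour : ∀ {u a b} → deg G u ≡ 1 → T (G u a) → T (G u b) → a ≡ b
    deg≡1⇒unique-neighbour {u} {a} {b} d≡1 ga gb with a ≟ b
    ... | yes a≡b = a≡b
    ... | no  a≢b = ⊥-elim (1+n≰n (subst (2 ≤_) d≡1 (2≤deg ga gb a≢b)))

    no-leaf-leaf-edge : ∀ {u v} → T (G u v) → ¬ (deg G u ≡ 1 × deg G v ≡ 1)
    no-leaf-leaf-edge {u} {v} g (du≡1 , dv≡1) with third-vertex u v
    ... | w , w≢u , w≢v = [ w≢u , w≢v ] (reachable-closed S closed (connected u w) (inj₁ refl))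
      where
      S : Fin (3 + k) → Set
      S x = x ≡ u ⊎ x ≡ v
      closed : ∀ {x y} → S x → T (G x y) → S y
      closed (inj₁ refl) gxy = inj₂ (sym (deg≡1⇒unique-neighbour du≡1 g gxy))
      closed (inj₂ refl) gxy = inj₁ (sym (deg≡1⇒unique-neighbour dv≡1 (subst T (G-sym u v) g) gxy))

    edge-counts : ∀ u v → T (G u v) → EndDegreeCounts (deg G u) (deg G v)
    edge-counts u v g = end-degree-counts (0<deg u) (maxdeg u) (0<deg v) (maxdeg v) (no-leaf-leaf-edge g)

    private
      t : ℕ → ℕ → Fin (3 + k) → Fin (3 + k) → ℕ
      t i j u v = τ i j (deg G u) (deg G v)

    ends-of-degree : ∀ i → i * n[ i ] ≡ ∑ₑ (λ u v → 𝟙 (deg G u ≡ᵇ i) + 𝟙 (deg G v ≡ᵇ i))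
    ends-of-degree i =
      trans (*-distribˡ-sum i (λ u → 𝟙 (deg G u ≡ᵇ i)))
            (trans (sum-cong-≗ λ u → i*𝟙[a≡ᵇi]≡𝟙[a≡ᵇi]*a i (deg G u))
                   (handshake (λ u → 𝟙 (deg G u ≡ᵇ i))))

    m₁₂+m₁₃≡n₁ : m G 1 2 + m G 1 3 ≡ n[ 1 ]
    m₁₂+m₁₃≡n₁ = begin
      m G 1 2 + m G 1 3                         ≡⟨ cong₂ _+_ (m≡∑ₑ 1 2) (m≡∑ₑ 1 3) ⟩
      ∑ₑ (t 1 2) + ∑ₑ (t 1 3)                   ≡⟨ sym (∑ₑ-+ (t 1 2) (t 1 3)) ⟩
      ∑ₑ (λ u v → t 1 2 u v + t 1 3 u v)        ≡⟨ ∑ₑ-cong (λ u v g → sym (EndDegreeCounts.ends₁ (edge-counts u v g))) ⟩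
      ∑ₑ (λ u v → 𝟙 (deg G u ≡ᵇ 1) + 𝟙 (deg G v ≡ᵇ 1)) ≡⟨ sym (ends-of-degree 1) ⟩
      1 * n[ 1 ]                                ≡⟨ *-identityˡ n[ 1 ] ⟩
      n[ 1 ]                                    ∎
      where open ≡-Reasoning

    m₁₂+2m₂₂+m₂₃≡2n₂ : m G 1 2 + 2 * m G 2 2 + m G 2 3 ≡ 2 * n[ 2 ]
    m₁₂+2m₂₂+m₂₃≡2n₂ = begin
      m G 1 2 + 2 * m G 2 2 + m G 2 3
        ≡⟨ cong₂ _+_ (cong₂ _+_ (m≡∑ₑ 1 2) (cong (2 *_) (m≡∑ₑ 2 2))) (m≡∑ₑ 2 3) ⟩
      ∑ₑ (t 1 2) + 2 * ∑ₑ (t 2 2) + ∑ₑ (t 2 3)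
        ≡⟨ cong (_+ ∑ₑ (t 2 3)) (trans (cong (∑ₑ (t 1 2) +_) (sym (∑ₑ-*ˡ 2 (t 2 2))))
                                       (sym (∑ₑ-+ (t 1 2) (λ u v → 2 * t 2 2 u v)))) ⟩
      ∑ₑ (λ u v → t 1 2 u v + 2 * t 2 2 u v) + ∑ₑ (t 2 3)
        ≡⟨ sym (∑ₑ-+ (λ u v → t 1 2 u v + 2 * t 2 2 u v) (t 2 3)) ⟩
      ∑ₑ (λ u v → t 1 2 u v + 2 * t 2 2 u v + t 2 3 u v)
        ≡⟨ ∑ₑ-cong (λ u v g → sym (EndDegreeCounts.ends₂ (edge-counts u v g))) ⟩
      ∑ₑ (λ u v → 𝟙 (deg G u ≡ᵇ 2) + 𝟙 (deg G v ≡ᵇ 2))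
        ≡⟨ sym (ends-of-degree 2) ⟩
      2 * n[ 2 ] ∎
      where open ≡-Reasoning

    m₁₃+m₂₃+2m₃₃≡3n₃ : m G 1 3 + m G 2 3 + 2 * m G 3 3 ≡ 3 * n[ 3 ]
    m₁₃+m₂₃+2m₃₃≡3n₃ = begin
      m G 1 3 + m G 2 3 + 2 * m G 3 3
        ≡⟨ cong₂ _+_ (cong₂ _+_ (m≡∑ₑ 1 3) (m≡∑ₑ 2 3)) (cong (2 *_) (m≡∑ₑ 3 3)) ⟩
      ∑ₑ (t 1 3) + ∑ₑ (t 2 3) + 2 * ∑ₑ (t 3 3)
        ≡⟨ cong₂ _+_ (sym (∑ₑ-+ (t 1 3) (t 2 3))) (sym (∑ₑ-*ˡ 2 (t 3 3))) ⟩
      ∑ₑ (λ u v → t 1 3 u v + t 2 3 u v) + ∑ₑ (λ u v → 2 * t 3 3 u v)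
        ≡⟨ sym (∑ₑ-+ (λ u v → t 1 3 u v + t 2 3 u v) (λ u v → 2 * t 3 3 u v)) ⟩
      ∑ₑ (λ u v → t 1 3 u v + t 2 3 u v + 2 * t 3 3 u v)
        ≡⟨ ∑ₑ-cong (λ u v g → sym (EndDegreeCounts.ends₃ (edge-counts u v g))) ⟩
      ∑ₑ (λ u v → 𝟙 (deg G u ≡ᵇ 3) + 𝟙 (deg G v ≡ᵇ 3))
        ≡⟨ sym (ends-of-degree 3) ⟩
      3 * n[ 3 ] ∎
      where open ≡-Reasoning

    ∑m≡numEdges : m G 1 2 + m G 1 3 + m G 2 2 + m G 2 3 + m G 3 3 ≡ numEdges G
    ∑m≡numEdges = begin
      m G 1 2 + m G 1 3 + m G 2 2 + m G 2 3 + m G 3 3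
        ≡⟨ cong₂ _+_ (cong₂ _+_ (cong₂ _+_ (cong₂ _+_ (m≡∑ₑ 1 2) (m≡∑ₑ 1 3)) (m≡∑ₑ 2 2)) (m≡∑ₑ 2 3)) (m≡∑ₑ 3 3) ⟩
      ∑ₑ (t 1 2) + ∑ₑ (t 1 3) + ∑ₑ (t 2 2) + ∑ₑ (t 2 3) + ∑ₑ (t 3 3)
        ≡⟨ cong (λ x → x + ∑ₑ (t 2 2) + ∑ₑ (t 2 3) + ∑ₑ (t 3 3)) (sym (∑ₑ-+ (t 1 2) (t 1 3))) ⟩
      ∑ₑ (λ u v → t 1 2 u v + t 1 3 u v) + ∑ₑ (t 2 2) + ∑ₑ (t 2 3) + ∑ₑ (t 3 3)
        ≡⟨ cong (λ x → x + ∑ₑ (t 2 3) + ∑ₑ (t 3 3)) (sym (∑ₑ-+ (λ u v → t 1 2 u v + t 1 3 u v) (t 2 2))) ⟩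
      ∑ₑ (λ u v → t 1 2 u v + t 1 3 u v + t 2 2 u v) + ∑ₑ (t 2 3) + ∑ₑ (t 3 3)
        ≡⟨ cong (_+ ∑ₑ (t 3 3)) (sym (∑ₑ-+ (λ u v → t 1 2 u v + t 1 3 u v + t 2 2 u v) (t 2 3))) ⟩
      ∑ₑ (λ u v → t 1 2 u v + t 1 3 u v + t 2 2 u v + t 2 3 u v) + ∑ₑ (t 3 3)
        ≡⟨ sym (∑ₑ-+ (λ u v → t 1 2 u v + t 1 3 u v + t 2 2 u v + t 2 3 u v) (t 3 3)) ⟩
      ∑ₑ (λ u v → t 1 2 u v + t 1 3 u v + t 2 2 u v + t 2 3 u v + t 3 3 u v)
        ≡⟨ ∑ₑ-cong (λ u v g → sym (EndDegreeCounts.types (edge-counts u v g))) ⟩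
      ∑ₑ (λ _ _ → 1)
        ≡⟨ sym numEdges≡∑ₑ1 ⟩
      numEdges G ∎
      where open ≡-Reasoning

    n₁+n₂+n₃≡n : n[ 1 ] + n[ 2 ] + n[ 3 ] ≡ 3 + k
    n₁+n₂+n₃≡n = begin
      n[ 1 ] + n[ 2 ] + n[ 3 ]
        ≡⟨ cong (_+ n[ 3 ]) (sym (∑-distrib-+ (λ u → 𝟙 (deg G u ≡ᵇ 1)) (λ u → 𝟙 (deg G u ≡ᵇ 2)))) ⟩
      ∑[ u < 3 + k ] (𝟙 (deg G u ≡ᵇ 1) + 𝟙 (deg G u ≡ᵇ 2)) + n[ 3 ]
        ≡⟨ sym (∑-distrib-+ (λ u → 𝟙 (deg G u ≡ᵇ 1) + 𝟙 (deg G u ≡ᵇ 2)) (λ u → 𝟙 (deg G u ≡ᵇ 3))) ⟩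
      ∑[ u < 3 + k ] (𝟙 (deg G u ≡ᵇ 1) + 𝟙 (deg G u ≡ᵇ 2) + 𝟙 (deg G u ≡ᵇ 3))
        ≡⟨ sum-cong-≗ (λ u → degree-classes (0<deg u) (maxdeg u)) ⟩
      ∑[ u < 3 + k ] 1
        ≡⟨ ∑-1≡n (3 + k) ⟩
      3 + k ∎
      where open ≡-Reasoning

  least : (p : ℕ → Bool) → ∀ j → T (p j) → ∃ λ h → T (p h) × (∀ i → i < h → ¬ T (p i))
  least p zero    pj = 0 , pj , λ _ ()
  least p (suc j) pj with least (p ∘ suc) j pj | p 0 in p0
  ... | _            | true  = 0 , subst T (sym p0) _ , λ _ ()
  ... | h , ph , ¬pi | false = suc h , ph , λ where
    zero    _         p0′ → subst T p0 p0′
    (suc i) (s≤s i<h)     → ¬pi i i<h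

  x≤x*s+[1∸s] : ∀ {x s} → x ≤ 1 → s ≤ 1 → x ≤ x * s + (1 ∸ s)
  x≤x*s+[1∸s] {0}                   _ _ = z≤n
  x≤x*s+[1∸s] {1} {0}               _ _ = s≤s z≤n
  x≤x*s+[1∸s] {1} {1}               _ _ = s≤s z≤n
  x≤x*s+[1∸s] {1} {suc (suc _)}     _ (s≤s ())
  x≤x*s+[1∸s] {suc (suc _)}         (s≤s ()) _

  τ₃₃≡ : ∀ a b → τ 3 3 a b ≡ 𝟙 (a ≡ᵇ 3) * 𝟙 (b ≡ᵇ 3)
  τ₃₃≡ a b = trans (cong 𝟙 (∨-idem ((a ≡ᵇ 3) ∧ (b ≡ᵇ 3)))) (𝟙-∧ (a ≡ᵇ 3) (b ≡ᵇ 3))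

  module Spanning-Tree {n : ℕ} (G : Graph n) (simple : IsSimple G) (connected : Connected G) (r : Fin n) where

    open Graph-Sums G
    open Simple-Graph G simple

    within : ℕ → Fin n → Bool
    within zero    v = ⌊ v ≟ r ⌋
    within (suc j) v = within j v ∨ ⌊ any? (λ w → T? (within j w ∧ G w v)) ⌋

    reachable⇒within : ∀ {v} → Reachable G v r → ∃ λ j → T (within j v)
    reachable⇒within here = 0 , fromWitness refl
    reachable⇒within {v} (step {v = w} g walk) with reachable⇒within walk
    ... | j , wj = suc j , Equivalence.from (T-∨ {within j v}) (inj₂ (fromWitness {a? = any? _}
                              (w , Equivalence.from (T-∧ {within j w}) (wj , subst T (G-sym v w) g))))

    dist-least : ∀ v → ∃ λ h → T (within h v) × (∀ i → i < h → ¬ T (within i v))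
    dist-least v = least (λ j → within j v) (proj₁ w) (proj₂ w)
      where w = reachable⇒within (connected v r)

    dist : Fin n → ℕ
    dist v = proj₁ (dist-least v)

    dist≤ : ∀ {v j} → T (within j v) → dist v ≤ j
    dist≤ {v} {j} wj = ≮⇒≥ λ j<d → proj₂ (proj₂ (dist-least v)) j j<d wj

    earlier-neighbour : ∀ {v} j → T (within j v) → (∀ i → i < j → ¬ T (within i v)) → ¬ v ≡ r →
                        ∃ λ w → T (G w v) × dist w < j
    earlier-neighbour zero    wv _     v≢r = ⊥-elim (v≢r (toWitness wv))
    earlier-neighbour {v} (suc j) wv first v≢r with Equivalence.to (T-∨ {within j v}) wv
    ... | inj₁ wj  = ⊥-elim (first j ≤-refl wj)
    ... | inj₂ any with toWitness any
    ...   | w , t with Equivalence.to (T-∧ {within j w}) t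
    ...     | wj , g = w , g , s≤s (dist≤ wj)

    parent-data : ∀ v → ¬ v ≡ r → ∃ λ w → T (G w v) × dist w < dist v
    parent-data v = earlier-neighbour (dist v) (proj₁ (proj₂ (dist-least v))) (proj₂ (proj₂ (dist-least v)))

    parent : Fin n → Fin n
    parent v with v ≟ r
    ... | yes _   = r
    ... | no  v≢r = proj₁ (parent-data v v≢r)

    parent-dist : ∀ {v} → ¬ v ≡ r → dist (parent v) < dist v
    parent-dist {v} v≢r with v ≟ r
    ... | yes v≡r  = ⊥-elim (v≢r v≡r)
    ... | no  v≢r′ = proj₂ (proj₂ (parent-data v v≢r′))

    nonroot : Fin n → ℕ
    nonroot v = 𝟙 (not (does (v ≟ r)))

    ∑nonroot+1≡n : ∑[ v < n ] nonroot v + 1 ≡ n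
    ∑nonroot+1≡n = begin
      ∑[ v < n ] nonroot v + 1                  ≡⟨ cong (∑[ v < n ] nonroot v +_) (sym (∑-δ≡1 r)) ⟩
      ∑[ v < n ] nonroot v + ∑[ v < n ] δ v r   ≡⟨ sym (∑-distrib-+ nonroot (λ v → δ v r)) ⟩
      ∑[ v < n ] (nonroot v + δ v r)            ≡⟨ sum-cong-≗ nonroot+δ≡1 ⟩
      ∑[ v < n ] 1                              ≡⟨ ∑-1≡n n ⟩
      n                                         ∎
      where
      open ≡-Reasoning
      nonroot+δ≡1 : ∀ v → nonroot v + δ v r ≡ 1
      nonroot+δ≡1 v with v ≟ r
      ... | yes _ = refl
      ... | no  _ = refl

    childᵇ : Fin n → Fin n → Bool
    childᵇ u v = does (u ≟ parent v) ∧ not (does (v ≟ r))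

    child : Fin n → Fin n → ℕ
    child u v = 𝟙 (childᵇ u v)

    tree : Fin n → Fin n → ℕ
    tree u v = child u v + child v u

    childᵇ⇒dist< : ∀ {u v} → T (childᵇ u v) → dist u < dist v
    childᵇ⇒dist< {u} {v} c with u ≟ parent v
    ... | yes refl = parent-dist v≢r
      where
      v≢r : ¬ v ≡ r
      v≢r v≡r with v ≟ r
      ... | yes _   = c
      ... | no  v≢r = v≢r v≡r

    tree≤1 : ∀ u v → tree u v ≤ 1
    tree≤1 u v with childᵇ u v in c₁ | childᵇ v u in c₂
    ... | false | c     = 𝟙≤1 c
    ... | true  | false = ≤-refl
    ... | true  | true  = ⊥-elim (<-asym (childᵇ⇒dist< {u} {v} (subst T (sym c₁) _))
                                         (childᵇ⇒dist< {v} {u} (subst T (sym c₂) _)))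

    ∑-children : (g : Fin n → Fin n → ℕ) →
      ∑ₑ (λ u v → g u v * child u v + g v u * child v u) ≡ ∑[ v < n ] (g (parent v) v * nonroot v)
    ∑-children g = begin
      ∑ₑ (λ u v → g u v * child u v + g v u * child v u)
        ≡⟨ sym (∑-adj≡∑ₑ (λ u v → g u v * child u v)) ⟩
      ∑[ u < n ] ∑[ v < n ] (𝟙 (G u v) * (g u v * child u v))
        ≡⟨ ∑-comm (λ u v → 𝟙 (G u v) * (g u v * child u v)) ⟩
      ∑[ v < n ] ∑[ u < n ] (𝟙 (G u v) * (g u v * child u v))
        ≡⟨ sum-cong-≗ (λ v → sum-cong-≗ λ u → regroup u v) ⟩
      ∑[ v < n ] ∑[ u < n ] (δ u (parent v) * (𝟙 (G u v) * g u v * nonroot v))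
        ≡⟨ sum-cong-≗ (λ v → ∑-δ (parent v) (λ u → 𝟙 (G u v) * g u v * nonroot v)) ⟩
      ∑[ v < n ] (𝟙 (G (parent v) v) * g (parent v) v * nonroot v)
        ≡⟨ sum-cong-≗ parent-edge ⟩
      ∑[ v < n ] (g (parent v) v * nonroot v) ∎
      where
      open ≡-Reasoning
      regroup : ∀ u v → 𝟙 (G u v) * (g u v * child u v) ≡ δ u (parent v) * (𝟙 (G u v) * g u v * nonroot v)
      regroup u v = trans (cong (λ x → 𝟙 (G u v) * (g u v * x)) (𝟙-∧ (does (u ≟ parent v)) (not (does (v ≟ r)))))
                          (shuffle (𝟙 (G u v)) (g u v) (δ u (parent v)) (nonroot v))
        where
        shuffle : ∀ a b c d → a * (b * (c * d)) ≡ c * (a * b * d)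
        shuffle = solve-∀
      parent-edge : ∀ v → 𝟙 (G (parent v) v) * g (parent v) v * nonroot v ≡ g (parent v) v * nonroot v
      parent-edge v with v ≟ r
      ... | yes _   = trans (*-zeroʳ (𝟙 (G r v) * g r v)) (sym (*-zeroʳ (g r v)))
      ... | no  v≢r rewrite 𝟙-T (proj₁ (proj₂ (parent-data v v≢r))) =
        cong (_* 1) (+-identityʳ (g (proj₁ (parent-data v v≢r)) v))

    non-tree-edges : ∑ₑ (λ u v → 1 ∸ tree u v) + ∑[ v < n ] nonroot v ≡ numEdges G
    non-tree-edges = begin
      ∑ₑ (λ u v → 1 ∸ tree u v) + ∑[ v < n ] nonroot v
        ≡⟨ cong (∑ₑ (λ u v → 1 ∸ tree u v) +_) (sym ∑ₑtree≡∑nonroot) ⟩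
      ∑ₑ (λ u v → 1 ∸ tree u v) + ∑ₑ tree
        ≡⟨ sym (∑ₑ-+ (λ u v → 1 ∸ tree u v) tree) ⟩
      ∑ₑ (λ u v → 1 ∸ tree u v + tree u v)
        ≡⟨ ∑ₑ-cong (λ u v _ → m∸n+n≡m (tree≤1 u v)) ⟩
      ∑ₑ (λ _ _ → 1)
        ≡⟨ sym numEdges≡∑ₑ1 ⟩
      numEdges G ∎
      where
      open ≡-Reasoning
      ∑ₑtree≡∑nonroot : ∑ₑ tree ≡ ∑[ v < n ] nonroot v
      ∑ₑtree≡∑nonroot = trans (∑ₑ-cong (λ u v _ → sym (cong₂ _+_ (*-identityˡ (child u v)) (*-identityˡ (child v u)))))
                              (trans (∑-children (λ _ _ → 1)) (sum-cong-≗ λ v → *-identityˡ (nonroot v)))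

    deg₃ : Fin n → ℕ
    deg₃ v = 𝟙 (deg G v ≡ᵇ 3)

    m₃₃≤tree+non-tree : m G 3 3 ≤ ∑ₑ (λ u v → deg₃ u * deg₃ v * child u v + deg₃ v * deg₃ u * child v u)
                     + ∑ₑ (λ u v → 1 ∸ tree u v)
    m₃₃≤tree+non-tree = begin
      m G 3 3
        ≡⟨ m≡∑ₑ 3 3 ⟩
      ∑ₑ (λ u v → τ 3 3 (deg G u) (deg G v))
        ≤⟨ ∑ₑ-mono-≤ covered ⟩
      ∑ₑ (λ u v → deg₃ u * deg₃ v * child u v + deg₃ v * deg₃ u * child v u + (1 ∸ tree u v))
        ≡⟨ ∑ₑ-+ (λ u v → deg₃ u * deg₃ v * child u v + deg₃ v * deg₃ u * child v u) (λ u v → 1 ∸ tree u v) ⟩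
      ∑ₑ (λ u v → deg₃ u * deg₃ v * child u v + deg₃ v * deg₃ u * child v u) + ∑ₑ (λ u v → 1 ∸ tree u v) ∎
      where
      open ≤-Reasoning
      covered : ∀ u v →
        τ 3 3 (deg G u) (deg G v) ≤ deg₃ u * deg₃ v * child u v + deg₃ v * deg₃ u * child v u + (1 ∸ tree u v)
      covered u v rewrite τ₃₃≡ (deg G u) (deg G v) | *-comm (deg₃ v) (deg₃ u)
                        | sym (*-distribˡ-+ (deg₃ u * deg₃ v) (child u v) (child v u)) =
        x≤x*s+[1∸s] (*-mono-≤ (𝟙≤1 (deg G u ≡ᵇ 3)) (𝟙≤1 (deg G v ≡ᵇ 3))) (tree≤1 u v)

    ∑deg₃*nonroot+1≡n₃ : deg G r ≡ 3 → ∑[ v < n ] (deg₃ v * nonroot v) + 1 ≡ n[ 3 ]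
    ∑deg₃*nonroot+1≡n₃ deg-r≡3 = begin
      ∑[ v < n ] (deg₃ v * nonroot v) + 1
        ≡⟨ cong (∑[ v < n ] (deg₃ v * nonroot v) +_) (sym deg₃-r) ⟩
      ∑[ v < n ] (deg₃ v * nonroot v) + ∑[ v < n ] (δ v r * deg₃ v)
        ≡⟨ sym (∑-distrib-+ (λ v → deg₃ v * nonroot v) (λ v → δ v r * deg₃ v)) ⟩
      ∑[ v < n ] (deg₃ v * nonroot v + δ v r * deg₃ v)
        ≡⟨ sum-cong-≗ split ⟩
      n[ 3 ] ∎
      where
      open ≡-Reasoning
      deg₃-r : ∑[ v < n ] (δ v r * deg₃ v) ≡ 1
      deg₃-r = trans (∑-δ r deg₃) (cong (λ d → 𝟙 (d ≡ᵇ 3)) deg-r≡3)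
      split : ∀ v → deg₃ v * nonroot v + δ v r * deg₃ v ≡ deg₃ v
      split v with v ≟ r
      ... | yes _ = trans (cong (_+ (deg₃ v + 0)) (*-zeroʳ (deg₃ v))) (+-identityʳ (deg₃ v))
      ... | no  _ = trans (+-identityʳ _) (*-identityʳ (deg₃ v))

    m₃₃+n≤n₃+numEdges : deg G r ≡ 3 → m G 3 3 + n ≤ n[ 3 ] + numEdges G
    m₃₃+n≤n₃+numEdges deg-r≡3 = begin
      m G 3 3 + n
        ≡⟨ cong (m G 3 3 +_) (sym ∑nonroot+1≡n) ⟩
      m G 3 3 + (N + 1)
        ≤⟨ +-monoˡ-≤ (N + 1) m₃₃≤tree+non-tree ⟩
      (X + Y) + (N + 1)
        ≡⟨ shuffle X Y N ⟩
      (X + 1) + (Y + N)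
        ≡⟨ cong ((X + 1) +_) non-tree-edges ⟩
      (X + 1) + numEdges G
        ≤⟨ +-monoˡ-≤ (numEdges G) (+-monoˡ-≤ 1 X≤) ⟩
      (∑[ v < n ] (deg₃ v * nonroot v) + 1) + numEdges G
        ≡⟨ cong (_+ numEdges G) (∑deg₃*nonroot+1≡n₃ deg-r≡3) ⟩
      n[ 3 ] + numEdges G ∎
      where
      open ≤-Reasoning
      shuffle : ∀ x y z → (x + y) + (z + 1) ≡ (x + 1) + (y + z)
      shuffle = solve-∀
      N = ∑[ v < n ] nonroot v
      X = ∑ₑ (λ u v → deg₃ u * deg₃ v * child u v + deg₃ v * deg₃ u * child v u)
      Y = ∑ₑ (λ u v → 1 ∸ tree u v)
      X≤ : X ≤ ∑[ v < n ] (deg₃ v * nonroot v)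
      X≤ = ≤-trans (≤-reflexive (∑-children (λ u v → deg₃ u * deg₃ v)))
                   (sum-mono-≤ λ v → *-monoˡ-≤ (nonroot v) (≤-trans (*-monoˡ-≤ (deg₃ v) (𝟙≤1 (deg G (parent v) ≡ᵇ 3)))
                                                                   (≤-reflexive (*-identityˡ (deg₃ v)))))

  toℕ≡ᵇtoℕ : ∀ {n} (u v : Fin n) → (toℕ u ≡ᵇ toℕ v) ≡ does (u ≟ v)
  toℕ≡ᵇtoℕ u v with u ≟ v
  ... | yes refl = T⇒≡true (≡⇒≡ᵇ (toℕ u) (toℕ u) refl)
  ... | no  u≢v  = ¬T⇒≡false (u≢v ∘ toℕ-injective ∘ ≡ᵇ⇒≡ (toℕ u) (toℕ v))

  𝟙-∨-disjoint : ∀ {n} (v a b : Fin n) → ¬ a ≡ b → 𝟙 (does (v ≟ a) ∨ does (v ≟ b)) ≡ δ v a + δ v b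
  𝟙-∨-disjoint v a b a≢b with v ≟ a | v ≟ b
  ... | yes refl | yes refl = ⊥-elim (a≢b refl)
  ... | yes _    | no _     = refl
  ... | no _     | _        = refl

  module Cycle (k : ℕ) where

    C : Graph (3 + k)
    C = cycle k

    next : Fin (3 + k) → Fin (3 + k)
    next u = fromℕ< (m%n<n (suc (toℕ u)) (3 + k))

    data NextView (u : Fin (3 + k)) : Set where
      inner : suc (toℕ u) < 3 + k → toℕ (next u) ≡ suc (toℕ u) → NextView u
      wrap  : suc (toℕ u) ≡ 3 + k → toℕ (next u) ≡ 0           → NextView u

    toℕ-next : ∀ u → toℕ (next u) ≡ suc (toℕ u) % (3 + k)
    toℕ-next u = toℕ-fromℕ< (m%n<n (suc (toℕ u)) (3 + k))

    next-view : ∀ u → NextView u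
    next-view u with m≤n⇒m<n∨m≡n (toℕ<n u)
    ... | inj₁ 1+u<n = inner 1+u<n (trans (toℕ-next u) (m<n⇒m%n≡m 1+u<n))
    ... | inj₂ 1+u≡n = wrap 1+u≡n (trans (toℕ-next u) (trans (cong (_% (3 + k)) 1+u≡n) (n%n≡0 (3 + k))))

    next-irrefl : ∀ u → ¬ next u ≡ u
    next-irrefl u e with next-view u
    ... | inner _ t = 1+n≢n (trans (sym t) (cong toℕ e))
    ... | wrap  l t with trans (sym t) (cong toℕ e)
    ...   | 0≡u = 0≢1+n (suc-injective (trans (cong suc 0≡u) l))

    next-injective : ∀ {u v} → next u ≡ next v → u ≡ v
    next-injective {u} {v} e with next-view u | next-view v
    ... | inner _ tu | inner _ tv = toℕ-injective (suc-injective (trans (sym tu) (trans (cong toℕ e) tv)))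
    ... | inner _ tu | wrap  _ tv = ⊥-elim (1+n≢0 (trans (sym tu) (trans (cong toℕ e) tv)))
    ... | wrap  _ tu | inner _ tv = ⊥-elim (1+n≢0 (trans (sym tv) (trans (sym (cong toℕ e)) tu)))
    ... | wrap  lu _ | wrap  lv _ = toℕ-injective (suc-injective (trans lu (sym lv)))

    2≢3+k : ¬ 2 ≡ 3 + k
    2≢3+k ()

    next²-irrefl : ∀ u → ¬ next (next u) ≡ u
    next²-irrefl u e with next-view u | next-view (next u)
    ... | inner _ t | inner _ t′ = m≢1+n+m (toℕ u) {1} (trans (sym (cong toℕ e)) (trans t′ (cong suc t)))
    ... | inner _ t | wrap l′ t′ = 2≢3+k (trans (cong (2 +_) (trans (sym t′) (cong toℕ e))) (trans (cong suc (sym t)) l′))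
    ... | wrap l t | inner _ t′ = 2≢3+k (trans (cong suc (trans (cong suc (sym t)) (trans (sym t′) (cong toℕ e)))) l)
    ... | wrap _ t | wrap _ t′ = next-irrefl (next u) (toℕ-injective (trans t′ (sym t)))

    prev-data : ∀ u → ∃ λ v → next v ≡ u
    prev-data u with toℕ u in eq
    ... | zero  = fromℕ (2 + k) , toℕ-injective (trans (toℕ-next (fromℕ (2 + k)))
                    (trans (cong (λ a → suc a % (3 + k)) (toℕ-fromℕ (2 + k))) (trans (n%n≡0 (3 + k)) (sym eq))))
    ... | suc a = fromℕ< a<n , toℕ-injective (trans (toℕ-next (fromℕ< a<n))
                    (trans (cong (λ b → suc b % (3 + k)) (toℕ-fromℕ< a<n)) (trans (m<n⇒m%n≡m 1+a<n) (sym eq))))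
      where
      1+a<n : suc a < 3 + k
      1+a<n = subst (_< 3 + k) eq (toℕ<n u)
      a<n : a < 3 + k
      a<n = <-trans (n<1+n a) 1+a<n

    prev : Fin (3 + k) → Fin (3 + k)
    prev u = proj₁ (prev-data u)

    next-prev : ∀ u → next (prev u) ≡ u
    next-prev u = proj₂ (prev-data u)

    C≡ : ∀ u v → C u v ≡ does (v ≟ next u) ∨ does (v ≟ prev u)
    C≡ u v = cong₂ _∨_ (trans (cong (toℕ v ≡ᵇ_) (sym (toℕ-next u))) (toℕ≡ᵇtoℕ v (next u)))
                       (trans (cong (toℕ u ≡ᵇ_) (sym (toℕ-next v))) (trans (toℕ≡ᵇtoℕ u (next v)) u≡next⇔prev≡))
      where
      u≡next⇔prev≡ : does (u ≟ next v) ≡ does (v ≟ prev u)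
      u≡next⇔prev≡ with u ≟ next v | v ≟ prev u
      ... | yes _    | yes _    = refl
      ... | no _     | no _     = refl
      ... | yes refl | no v≢p   = ⊥-elim (v≢p (next-injective (sym (next-prev (next v)))))
      ... | no u≢n   | yes refl = ⊥-elim (u≢n (sym (next-prev u)))

    next≢prev : ∀ u → ¬ next u ≡ prev u
    next≢prev u e = next²-irrefl u (trans (cong next e) (next-prev u))

    C-simple : IsSimple C
    C-simple = (λ u v → ∨-comm (toℕ v ≡ᵇ suc (toℕ u) % (3 + k)) (toℕ u ≡ᵇ suc (toℕ v) % (3 + k)))
             , (λ u → trans (C≡ u u) (cong₂ _∨_ (dec-false (u ≟ next u) (next-irrefl u ∘ sym))
                                                (dec-false (u ≟ prev u) λ u≡p → next-irrefl u (trans (cong next u≡p) (next-prev u)))))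

    open Graph-Sums C
    open Simple-Graph C C-simple

    C-deg : ∀ u → deg C u ≡ 2
    C-deg u = begin
      deg C u                                              ≡⟨ deg≡∑ u ⟩
      ∑[ v < 3 + k ] 𝟙 (C u v)                             ≡⟨ sum-cong-≗ (λ v → trans (cong 𝟙 (C≡ u v))
                                                                (𝟙-∨-disjoint v (next u) (prev u) (next≢prev u))) ⟩
      ∑[ v < 3 + k ] (δ v (next u) + δ v (prev u))         ≡⟨ ∑-distrib-+ (λ v → δ v (next u)) (λ v → δ v (prev u)) ⟩
      ∑[ v < 3 + k ] δ v (next u) + ∑[ v < 3 + k ] δ v (prev u) ≡⟨ cong₂ _+_ (∑-δ≡1 (next u)) (∑-δ≡1 (prev u)) ⟩
      2                                                    ∎
      where open ≡-Reasoning

    C-m≡0 : ∀ i j → hasType i j 2 2 ≡ false → m C i j ≡ 0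
    C-m≡0 i j = regular⇒m≡0 {i = i} {j} C-deg

    C-next : ∀ u → T (C u (next u))
    C-next u = subst T (sym (C≡ u (next u))) (subst (λ b → T (b ∨ does (next u ≟ prev u)))
                                                    (sym (dec-true (next u ≟ next u) refl)) _)

    zero-reaches : ∀ j (j<n : j < 3 + k) → Reachable C zero (fromℕ< j<n)
    zero-reaches zero    _     = here
    zero-reaches (suc j) 1+j<n = reachable-trans (zero-reaches j j<n)
                                   (step (subst (T ∘ C (fromℕ< j<n)) next≡ (C-next (fromℕ< j<n))) here)
      where
      j<n : j < 3 + k
      j<n = <-trans (n<1+n j) 1+j<n
      next≡ : next (fromℕ< j<n) ≡ fromℕ< 1+j<n
      next≡ = toℕ-injective (trans (toℕ-next (fromℕ< j<n))
                (trans (cong (λ a → suc a % (3 + k)) (toℕ-fromℕ< j<n))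
                       (trans (m<n⇒m%n≡m 1+j<n) (sym (toℕ-fromℕ< 1+j<n)))))

    C-connected : Connected C
    C-connected u v = reachable-trans (reachable-sym (reaches u)) (reaches v)
      where
      reaches : ∀ w → Reachable C zero w
      reaches w = subst (Reachable C zero) (fromℕ<-toℕ w (toℕ<n w)) (zero-reaches (toℕ w) (toℕ<n w))

    C-numEdges : numEdges C ≡ 3 + k
    C-numEdges = *-cancelˡ-≡ (numEdges C) (3 + k) 2 (begin
      2 * numEdges C                      ≡⟨ cong (2 *_) numEdges≡∑ₑ1 ⟩
      2 * ∑ₑ (λ _ _ → 1)                  ≡⟨ sym (∑ₑ-*ˡ 2 (λ _ _ → 1)) ⟩
      ∑ₑ (λ _ _ → 2)                      ≡⟨ sym (handshake (λ _ → 1)) ⟩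
      ∑[ u < 3 + k ] (1 * deg C u)        ≡⟨ sum-cong-≗ (λ u → trans (*-identityˡ (deg C u)) (C-deg u)) ⟩
      ∑[ u < 3 + k ] 2                    ≡⟨ trans (sym (*-distribˡ-sum {3 + k} 2 (λ _ → 1))) (cong (2 *_) (∑-1≡n (3 + k))) ⟩
      2 * (3 + k)                         ∎)
      where open ≡-Reasoning

    C-∈-𝒢₃ : 𝒢₃ (3 + k) (3 + k) C
    C-∈-𝒢₃ = C-simple , C-connected , (λ u → subst (_≤ 3) (sym (C-deg u)) (s≤s (s≤s z≤n))) , C-numEdges

  module Two-Regular (k : ℕ) (G : Graph (3 + k)) (simple : IsSimple G) (connected : Connected G)
                     (2-regular : ∀ u → deg G u ≡ 2) where

    open Graph-Sums G
    open Simple-Graph G simple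
    open Cycle k using (next; prev; next-prev; next≢prev; NextView; inner; wrap; next-view; C≡)

    no-third-neighbour : ∀ {x a b c} → T (G x a) → T (G x b) → ¬ a ≡ b → T (G x c) → c ≡ a ⊎ c ≡ b
    no-third-neighbour {x} {a} {b} {c} ga gb a≢b gc with c ≟ a | c ≟ b
    ... | yes c≡a | _       = inj₁ c≡a
    ... | no  _   | yes c≡b = inj₂ c≡b
    ... | no  c≢a | no  c≢b = ⊥-elim (1+n≰n (subst (3 ≤_) (2-regular x)
                                (3≤deg ga gb gc a≢b (c≢a ∘ sym) (c≢b ∘ sym))))

    other-neighbour : ∀ u w → ∃ λ v → T (G u v) × ¬ v ≡ w
    other-neighbour u w with any? (λ v → T? (G u v) ×-dec ¬? (v ≟ w))
    ... | yes found = found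
    ... | no  none  = ⊥-elim (1+n≰n (subst₂ _≤_ (2-regular u) (∑-δ≡1 w)
                        (subst (_≤ ∑[ v < 3 + k ] δ v w) (sym (deg≡∑ u)) (sum-mono-≤ only-w))))
      where
      only-w : ∀ v → 𝟙 (G u v) ≤ δ v w
      only-w v with G u v in g | v ≟ w
      ... | false | _      = z≤n
      ... | true  | yes _  = ≤-refl
      ... | true  | no v≢w = ⊥-elim (none (v , subst T (sym g) _ , v≢w))

    walk : ℕ → Fin (3 + k)
    walk zero          = zero
    walk (suc zero)    = proj₁ (other-neighbour zero zero)
    walk (suc (suc i)) = proj₁ (other-neighbour (walk (suc i)) (walk i))

    walk-adj : ∀ i → T (G (walk i) (walk (suc i)))
    walk-adj zero    = proj₁ (proj₂ (other-neighbour zero zero))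
    walk-adj (suc i) = proj₁ (proj₂ (other-neighbour (walk (suc i)) (walk i)))

    walk-adj′ : ∀ i → T (G (walk (suc i)) (walk i))
    walk-adj′ i = subst T (G-sym (walk i) (walk (suc i))) (walk-adj i)

    walk-non-backtracking : ∀ i → ¬ walk (2 + i) ≡ walk i
    walk-non-backtracking i = proj₂ (proj₂ (other-neighbour (walk (suc i)) (walk i)))

    walk-neighbours : ∀ i {c} → T (G (walk (suc i)) c) → c ≡ walk i ⊎ c ≡ walk (2 + i)
    walk-neighbours i = no-third-neighbour (walk-adj′ i) (walk-adj (suc i)) (walk-non-backtracking i ∘ sym)

    adj-irrefl : ∀ {x y} → T (G x y) → ¬ x ≡ y
    adj-irrefl {x} g refl = subst T (G-irrefl x) g

    repeatsᵇ : ℕ → Bool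
    repeatsᵇ j = ⌊ any? (λ (i : Fin j) → walk (toℕ i) ≟ walk j) ⌋

    repeats-intro : ∀ {i j} → i < j → walk i ≡ walk j → T (repeatsᵇ j)
    repeats-intro i<j e = fromWitness (fromℕ< i<j , trans (cong walk (toℕ-fromℕ< i<j)) e)

    repeats-elim : ∀ {j} → T (repeatsᵇ j) → ∃ λ i → i < j × walk i ≡ walk j
    repeats-elim t with toWitness t
    ... | i , e = toℕ i , toℕ<n i , e

    -- Opaque because unfolding pigeonhole during later unification makes type checking explode.
    opaque
      first-repeat : ∃ λ p → T (repeatsᵇ p) × (∀ j → j < p → ¬ T (repeatsᵇ j))
      first-repeat = let (i , j , i<j , e) = pigeonhole (n<1+n (3 + k)) (walk ∘ toℕ)
                     in least repeatsᵇ (toℕ j) (repeats-intro i<j e)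

    period : ℕ
    period = proj₁ first-repeat

    period-repeats : T (repeatsᵇ period)
    period-repeats = proj₁ (proj₂ first-repeat)

    no-repeat-before-period : ∀ {j} → j < period → ¬ T (repeatsᵇ j)
    no-repeat-before-period {j} = proj₂ (proj₂ first-repeat) j

    distinct-before-period : ∀ {i j} → i < period → j < period → walk i ≡ walk j → i ≡ j
    distinct-before-period {i} {j} i<p j<p e with <-cmp i j
    ... | tri< i<j _ _ = ⊥-elim (no-repeat-before-period j<p (repeats-intro i<j e))
    ... | tri≈ _ i≡j _ = i≡j
    ... | tri> _ _ j<i = ⊥-elim (no-repeat-before-period i<p (repeats-intro j<i (sym e)))

    last : ℕ
    last = pred period

    1+last≡period : suc last ≡ period
    1+last≡period with repeats-elim period-repeats
    ... | _ , i<p , _ = suc-pred period ⦃ >-nonZero (≤-trans (s≤s z≤n) i<p) ⦄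

    last<period : last < period
    last<period = subst (last <_) 1+last≡period ≤-refl

    -- Any other repeated vertex would already have both of its neighbours on the walk.
    walk-period : walk period ≡ walk 0
    walk-period with repeats-elim period-repeats
    ... | zero  , _     , e = sym e
    ... | suc i , 1+i<p , e = ⊥-elim (back-to (walk-neighbours i adj-to-last))
      where
      1+i≤last : suc i ≤ last
      1+i≤last = ≤-pred (subst (suc i <_) (sym 1+last≡period) 1+i<p)
      adj-to-last : T (G (walk (suc i)) (walk last))
      adj-to-last = subst (λ x → T (G x (walk last))) (trans (cong walk 1+last≡period) (sym e)) (walk-adj′ last)
      back-to : walk last ≡ walk i ⊎ walk last ≡ walk (2 + i) → ⊥
      back-to (inj₁ e′) = no-repeat-before-period last<period (repeats-intro (≤-trans (n<1+n i) 1+i≤last) (sym e′))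
      back-to (inj₂ e′) with m≤n⇒m<n∨m≡n 1+i≤last
      ... | inj₂ 1+i≡last = adj-irrefl adj-to-last (cong walk 1+i≡last)
      ... | inj₁ 2+i≤last with m≤n⇒m<n∨m≡n 2+i≤last
      ...   | inj₁ 2+i<last = no-repeat-before-period last<period (repeats-intro 2+i<last (sym e′))
      ...   | inj₂ 2+i≡last = walk-non-backtracking (suc i)
                                (trans (cong walk (trans (cong suc 2+i≡last) 1+last≡period)) (sym e))

    3≤period : 3 ≤ period
    3≤period = closes-late period-repeats walk-period
      where
      closes-late : ∀ {p} → T (repeatsᵇ p) → walk p ≡ walk 0 → 3 ≤ p
      closes-late {zero} t _ with repeats-elim {0} t
      ... | _ , () , _
      closes-late {1}                   _ e = ⊥-elim (adj-irrefl (walk-adj 0) (sym e))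
      closes-late {2}                   _ e = ⊥-elim (walk-non-backtracking 0 e)
      closes-late {suc (suc (suc _))} _ _ = s≤s (s≤s (s≤s z≤n))

    walk-onto : ∀ u → ∃ λ j → j < period × walk j ≡ u
    walk-onto u = reachable-closed S closed (connected zero u) (0 , ≤-trans (s≤s z≤n) 3≤period , refl)
      where
      S : Fin (3 + k) → Set
      S x = ∃ λ j → j < period × walk j ≡ x
      last≢1 : ¬ walk last ≡ walk 1
      last≢1 e = <⇒≢ 3≤period (sym (trans (sym 1+last≡period)
                   (cong suc (distinct-before-period last<period (≤-trans (s≤s (s≤s z≤n)) 3≤period) e))))
      closed : ∀ {x y} → S x → T (G x y) → S y
      closed (zero , 0<p , refl) g
        with no-third-neighbour (subst (λ x → T (G x (walk last))) (trans (cong walk 1+last≡period) walk-period) (walk-adj′ last))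
                                (walk-adj 0) last≢1 g
      ... | inj₁ refl = last , last<period , refl
      ... | inj₂ refl = 1 , ≤-trans (s≤s (s≤s z≤n)) 3≤period , refl
      closed (suc j , 1+j<p , refl) g with walk-neighbours j g
      ... | inj₁ refl = j , <-trans (n<1+n j) 1+j<p , refl
      ... | inj₂ refl with m≤n⇒m<n∨m≡n 1+j<p
      ...   | inj₁ 2+j<p = 2 + j , 2+j<p , refl
      ...   | inj₂ 2+j≡p = 0 , ≤-trans (s≤s z≤n) 3≤period , trans (sym walk-period) (cong walk (sym 2+j≡p))

    period≡n : period ≡ 3 + k
    period≡n = ≤-antisym (injective⇒≤ {f = walk ∘ toℕ} λ e → toℕ-injective (distinct-before-period (toℕ<n _) (toℕ<n _) e))
                         (injective⇒≤ {f = index} λ {u} {v} e → trans (sym (walk-index u)) (trans (cong (walk ∘ toℕ) e) (walk-index v)))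
      where
      index : Fin (3 + k) → Fin period
      index u = fromℕ< (proj₁ (proj₂ (walk-onto u)))
      walk-index : ∀ u → walk (toℕ (index u)) ≡ u
      walk-index u = trans (cong walk (toℕ-fromℕ< (proj₁ (proj₂ (walk-onto u))))) (proj₂ (proj₂ (walk-onto u)))

    φ : Fin (3 + k) → Fin (3 + k)
    φ i = walk (toℕ i)

    φ-injective : ∀ {i j} → φ i ≡ φ j → i ≡ j
    φ-injective {i} {j} e = toℕ-injective (distinct-before-period (<p i) (<p j) e)
      where
      <p : ∀ i → toℕ i < period
      <p i = subst (toℕ i <_) (sym period≡n) (toℕ<n i)

    ψ : Fin (3 + k) → Fin (3 + k)
    ψ u = fromℕ< (subst (proj₁ (walk-onto u) <_) period≡n (proj₁ (proj₂ (walk-onto u))))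

    φ∘ψ : ∀ u → φ (ψ u) ≡ u
    φ∘ψ u = trans (cong walk (toℕ-fromℕ< (subst (proj₁ (walk-onto u) <_) period≡n (proj₁ (proj₂ (walk-onto u))))))
                  (proj₂ (proj₂ (walk-onto u)))

    ψ∘φ : ∀ i → ψ (φ i) ≡ i
    ψ∘φ i = φ-injective (φ∘ψ (φ i))

    G-φ-next : ∀ i → T (G (φ i) (φ (next i)))
    G-φ-next i with next-view i
    ... | inner _ t = subst (T ∘ G (φ i) ∘ walk) (sym t) (walk-adj (toℕ i))
    ... | wrap  l t = subst (T ∘ G (φ i)) (trans (cong walk (trans l (sym period≡n))) (trans walk-period (cong walk (sym t))))
                            (walk-adj (toℕ i))

    G-φ≡C : ∀ i j → G (φ i) (φ j) ≡ cycle k i j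
    G-φ≡C i j rewrite C≡ i j with j ≟ next i
    ... | yes refl = T⇒≡true (G-φ-next i)
    ... | no j≢next with j ≟ prev i
    ...   | yes refl = T⇒≡true (subst T (G-sym (φ j) (φ i)) (subst (T ∘ G (φ j) ∘ φ) (next-prev i) (G-φ-next j)))
    ...   | no j≢prev = ¬T⇒≡false λ g → [ j≢next ∘ φ-injective , j≢prev ∘ φ-injective ]
                          (no-third-neighbour (G-φ-next i) G-φ-prev (next≢prev i ∘ φ-injective) g)
      where
      G-φ-prev : T (G (φ i) (φ (prev i)))
      G-φ-prev = subst T (G-sym (φ (prev i)) (φ i)) (subst (T ∘ G (φ (prev i)) ∘ φ) (next-prev i) (G-φ-next (prev i)))

    ≅-cycle : G ≅ cycle k
    ≅-cycle = mk↔ₛ′ ψ φ ψ∘φ φ∘ψ , λ u v → trans (cong₂ G (sym (φ∘ψ u)) (sym (φ∘ψ v))) (G-φ≡C (ψ u) (ψ v))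

  𝟙-pos : ∀ {b} → 0 < 𝟙 b → T b
  𝟙-pos {true} _ = _

  deg≡2 : ∀ {d} → 1 ≤ d → d ≤ 3 → ¬ d ≡ 1 → ¬ d ≡ 3 → d ≡ 2
  deg≡2 {1} _ _ d≢1 _   = ⊥-elim (d≢1 refl)
  deg≡2 {2} _ _ _   _   = refl
  deg≡2 {3} _ _ _   d≢3 = ⊥-elim (d≢3 refl)
  deg≡2 {suc (suc (suc (suc _)))} _ (s≤s (s≤s (s≤s ()))) _ _

  module Unicyclic-Chemical-Graph (k : ℕ) (G : Graph (3 + k)) (G∈𝒢₃ : 𝒢₃ (3 + k) (3 + k) G) where

    simple : IsSimple G
    simple = proj₁ G∈𝒢₃

    connected : Connected G
    connected = proj₁ (proj₂ G∈𝒢₃)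

    size : numEdges G ≡ 3 + k
    size = proj₂ (proj₂ (proj₂ G∈𝒢₃))

    open Graph-Sums G
    open Chemical-Graph k G simple connected (proj₁ (proj₂ (proj₂ G∈𝒢₃)))

    n₃≡n₁ : n[ 3 ] ≡ n[ 1 ]
    n₃≡n₁ = +-cancelˡ-≡ (n[ 1 ] + 2 * n[ 2 ] + 2 * n[ 3 ]) n[ 3 ] n[ 1 ] (begin
      (n[ 1 ] + 2 * n[ 2 ] + 2 * n[ 3 ]) + n[ 3 ]
        ≡⟨ split-last n[ 1 ] n[ 2 ] n[ 3 ] ⟩
      n[ 1 ] + 2 * n[ 2 ] + 3 * n[ 3 ]
        ≡⟨ sym (cong₂ _+_ (cong₂ _+_ m₁₂+m₁₃≡n₁ m₁₂+2m₂₂+m₂₃≡2n₂) m₁₃+m₂₃+2m₃₃≡3n₃) ⟩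
      (m G 1 2 + m G 1 3) + (m G 1 2 + 2 * m G 2 2 + m G 2 3) + (m G 1 3 + m G 2 3 + 2 * m G 3 3)
        ≡⟨ each-edge-twice (m G 1 2) (m G 1 3) (m G 2 2) (m G 2 3) (m G 3 3) ⟩
      2 * (m G 1 2 + m G 1 3 + m G 2 2 + m G 2 3 + m G 3 3)
        ≡⟨ cong (2 *_) (trans ∑m≡numEdges (trans size (sym n₁+n₂+n₃≡n))) ⟩
      2 * (n[ 1 ] + n[ 2 ] + n[ 3 ])
        ≡⟨ double n[ 1 ] n[ 2 ] n[ 3 ] ⟩
      (n[ 1 ] + 2 * n[ 2 ] + 2 * n[ 3 ]) + n[ 1 ] ∎)
      where
      open ≡-Reasoning
      split-last : ∀ x y z → (x + 2 * y + 2 * z) + z ≡ x + 2 * y + 3 * z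
      split-last = solve-∀
      each-edge-twice : ∀ a b c d e → (a + b) + (a + 2 * c + d) + (b + d + 2 * e) ≡ 2 * (a + b + c + d + e)
      each-edge-twice = solve-∀
      double : ∀ x y z → 2 * (x + y + z) ≡ (x + 2 * y + 2 * z) + x
      double = solve-∀

    m₂₃-relation : m G 2 3 + m G 3 3 * 2 ≡ m G 1 2 * 3 + m G 1 3 * 2
    m₂₃-relation = +-cancelˡ-≡ (m G 1 3) _ _ (begin
      m G 1 3 + (m G 2 3 + m G 3 3 * 2) ≡⟨ regroup (m G 1 3) (m G 2 3) (m G 3 3) ⟩
      m G 1 3 + m G 2 3 + 2 * m G 3 3   ≡⟨ m₁₃+m₂₃+2m₃₃≡3n₃ ⟩
      3 * n[ 3 ]                        ≡⟨ cong (3 *_) (trans n₃≡n₁ (sym m₁₂+m₁₃≡n₁)) ⟩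
      3 * (m G 1 2 + m G 1 3)           ≡⟨ expand (m G 1 2) (m G 1 3) ⟩
      m G 1 3 + (m G 1 2 * 3 + m G 1 3 * 2) ∎)
      where
      open ≡-Reasoning
      regroup : ∀ b d e → b + (d + e * 2) ≡ b + d + 2 * e
      regroup = solve-∀
      expand : ∀ a b → 3 * (a + b) ≡ b + (a * 3 + b * 2)
      expand = solve-∀

    m₂₂-relation : m G 2 2 + (m G 1 2 * 4 + m G 1 3 * 3) ≡ 3 + k + m G 3 3
    m₂₂-relation = begin
      m G 2 2 + (m G 1 2 * 4 + m G 1 3 * 3)
        ≡⟨ split (m G 1 2) (m G 1 3) (m G 2 2) ⟩
      m G 1 2 + m G 1 3 + m G 2 2 + (m G 1 2 * 3 + m G 1 3 * 2)
        ≡⟨ cong (m G 1 2 + m G 1 3 + m G 2 2 +_) (sym m₂₃-relation) ⟩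
      m G 1 2 + m G 1 3 + m G 2 2 + (m G 2 3 + m G 3 3 * 2)
        ≡⟨ regroup (m G 1 2) (m G 1 3) (m G 2 2) (m G 2 3) (m G 3 3) ⟩
      (m G 1 2 + m G 1 3 + m G 2 2 + m G 2 3 + m G 3 3) + m G 3 3
        ≡⟨ cong (_+ m G 3 3) (trans ∑m≡numEdges size) ⟩
      3 + k + m G 3 3 ∎
      where
      open ≡-Reasoning
      split : ∀ a b c → c + (a * 4 + b * 3) ≡ a + b + c + (a * 3 + b * 2)
      split = solve-∀
      regroup : ∀ a b c d e → a + b + c + (d + e * 2) ≡ (a + b + c + d + e) + e
      regroup = solve-∀

    m₃₃≤m₁₂+m₁₃ : m G 3 3 ≤ m G 1 2 + m G 1 3
    m₃₃≤m₁₂+m₁₃ with n[ 3 ] in n₃-eq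
    ... | zero  = subst (_≤ m G 1 2 + m G 1 3) (sym m₃₃≡0) z≤n
      where
      m₃₃≡0 : m G 3 3 ≡ 0
      m₃₃≡0 = m+n≡0⇒m≡0 (m G 3 3) (m+n≡0⇒n≡0 (m G 1 3 + m G 2 3) (trans m₁₃+m₂₃+2m₃₃≡3n₃ (cong (3 *_) n₃-eq)))
    ... | suc _ with 0<sum⇒0<term (λ v → 𝟙 (deg G v ≡ᵇ 3)) (subst (0 <_) (sym n₃-eq) (s≤s z≤n))
    ...   | r , 0<𝟙 = begin
      m G 3 3           ≤⟨ +-cancelʳ-≤ (3 + k) (m G 3 3) n[ 3 ] (subst (m G 3 3 + (3 + k) ≤_) (cong (n[ 3 ] +_) size) bound) ⟩
      n[ 3 ]            ≡⟨ trans n₃≡n₁ (sym m₁₂+m₁₃≡n₁) ⟩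
      m G 1 2 + m G 1 3 ∎
      where
      open ≤-Reasoning
      open Spanning-Tree G simple connected r using (m₃₃+n≤n₃+numEdges)
      bound : m G 3 3 + (3 + k) ≤ n[ 3 ] + numEdges G
      bound = m₃₃+n≤n₃+numEdges (≡ᵇ⇒≡ (deg G r) 3 (𝟙-pos 0<𝟙))

    counts : UnicyclicCounts (3 + k) (m G 1 2) (m G 1 3) (m G 2 2) (m G 2 3) (m G 3 3)
    counts = record { m₂₂-relation = m₂₂-relation ; m₂₃-relation = m₂₃-relation ; m₃₃≤m₁₂+m₁₃ = m₃₃≤m₁₂+m₁₃ }

    no-pendant⇒≅cycle : m G 1 2 + m G 1 3 ≡ 0 → G ≅ cycle k
    no-pendant⇒≅cycle no-pendant = Two-Regular.≅-cycle k G simple connected λ u →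
      deg≡2 (0<deg u) (proj₁ (proj₂ (proj₂ G∈𝒢₃)) u) (absent n₁≡0 u) (absent (trans n₃≡n₁ n₁≡0) u)
      where
      n₁≡0 : n[ 1 ] ≡ 0
      n₁≡0 = trans (sym m₁₂+m₁₃≡n₁) no-pendant
      absent : ∀ {i} → n[ i ] ≡ 0 → ∀ u → ¬ deg G u ≡ i
      absent {i} nᵢ≡0 u refl = 1+n≰n (subst₂ _≤_ (𝟙-T (≡⇒≡ᵇ i i refl)) nᵢ≡0 (term≤sum (λ v → 𝟙 (deg G v ≡ᵇ i)) u))


    ≇cycle⇒pendant : ¬ G ≅ cycle k → 0 < m G 1 2 + m G 1 3
    ≇cycle⇒pendant G≇C with m G 1 2 + m G 1 3 in pendants
    ... | zero  = ⊥-elim (G≇C (no-pendant⇒≅cycle pendants))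
    ... | suc _ = s≤s z≤n

  module Ordered-Group {c ℓ₁ ℓ₂} (O : OrderedAbelianGroup c ℓ₁ ℓ₂) where

    open OrderedAbelianGroup O
      renaming (_<_ to _<ᵍ_; refl to ≈-refl; sym to ≈-sym; trans to ≈-trans; +-monoˡ-< to ∙-monoˡ-<)
    open import Algebra.Properties.Group group using (//-rightDividesˡ; ∙-cancelʳ)
    open import Algebra.Properties.CommutativeMonoid.Mult commutativeMonoid
      using (×-homo-+; ×-assocˡ; ×-distrib-+; ×-congʳ) renaming (_×_ to _×ᵐ_)
    open import Relation.Binary.Construct.StrictToNonStrict _≈_ _<ᵍ_ using () renaming (_≤_ to _≤ᵍ_; <⇒≤ to <ᵍ⇒≤ᵍ)
    open IsStrictTotalOrder isStrictTotalOrder using (<-respˡ-≈; <-respʳ-≈) renaming (trans to <ᵍ-trans)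

    ·≡× : ∀ k x → k · x ≡ k ×ᵐ x
    ·≡× zero    x = refl
    ·≡× (suc k) x = cong (x ∙_) (·≡× k x)

    ·-homo-+ : ∀ m n x → (m + n) · x ≈ m · x ∙ n · x
    ·-homo-+ m n x = subst₂ _≈_ (sym (·≡× (m + n) x)) (sym (cong₂ _∙_ (·≡× m x) (·≡× n x))) (×-homo-+ x m n)

    ·-assocˡ : ∀ m n x → m · (n · x) ≈ (m * n) · x
    ·-assocˡ m n x = subst₂ _≈_ (sym (trans (cong (m ·_) (·≡× n x)) (·≡× m (n ×ᵐ x)))) (sym (·≡× (m * n) x)) (×-assocˡ x m n)

    ·-distrib-∙ : ∀ m x y → m · (x ∙ y) ≈ m · x ∙ m · y
    ·-distrib-∙ m x y = subst₂ _≈_ (sym (·≡× m (x ∙ y))) (sym (cong₂ _∙_ (·≡× m x) (·≡× m y))) (×-distrib-+ x y m)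

    ·-congʳ : ∀ m {x y} → x ≈ y → m · x ≈ m · y
    ·-congʳ m {x} {y} x≈y = subst₂ _≈_ (sym (·≡× m x)) (sym (·≡× m y)) (×-congʳ m x≈y)

    ·-distrib-∙· : ∀ m x a y → m · (x ∙ a · y) ≈ m · x ∙ (m * a) · y
    ·-distrib-∙· m x a y = ≈-trans (·-distrib-∙ m x (a · y)) (∙-congˡ (·-assocˡ m a y))

    ∙-monoʳ-< : ∀ z {x y} → x <ᵍ y → z ∙ x <ᵍ z ∙ y
    ∙-monoʳ-< z {x} {y} x<y = <-respʳ-≈ (comm y z) (<-respˡ-≈ (comm x z) (∙-monoˡ-< z x<y))

    ε<∙ : ∀ {x y} → ε <ᵍ x → ε ≤ᵍ y → ε <ᵍ x ∙ y
    ε<∙ {x} {y} ε<x (inj₁ ε<y) = <ᵍ-trans ε<x (<-respˡ-≈ (identityʳ x) (∙-monoʳ-< x ε<y))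
    ε<∙ {x} {y} ε<x (inj₂ ε≈y) = <-respʳ-≈ (≈-trans (≈-sym (identityʳ x)) (∙-congˡ ε≈y)) ε<x

    ε≤∙ : ∀ {x y} → ε ≤ᵍ x → ε ≤ᵍ y → ε ≤ᵍ x ∙ y
    ε≤∙ (inj₁ ε<x) ε≤y        = inj₁ (ε<∙ ε<x ε≤y)
    ε≤∙ (inj₂ ε≈x) (inj₁ ε<y) = inj₁ (<-respʳ-≈ (comm _ _) (ε<∙ ε<y (inj₂ ε≈x)))
    ε≤∙ (inj₂ ε≈x) (inj₂ ε≈y) = inj₂ (≈-trans (≈-sym (identityʳ ε)) (∙-cong ε≈x ε≈y))

    ε≤· : ∀ m {x} → ε ≤ᵍ x → ε ≤ᵍ m · x
    ε≤· zero    _   = inj₂ ≈-refl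
    ε≤· (suc m) ε≤x = ε≤∙ ε≤x (ε≤· m ε≤x)

    ε<· : ∀ m {x} → ε <ᵍ x → ε <ᵍ suc m · x
    ε<· m ε<x = ε<∙ ε<x (ε≤· m (<ᵍ⇒≤ᵍ ε<x))

    ε<x∙y : ∀ {x y} → y ⁻¹ <ᵍ x → ε <ᵍ x ∙ y
    ε<x∙y {x} {y} y⁻¹<x = <-respˡ-≈ (inverseˡ y) (∙-monoˡ-< y y⁻¹<x)

    module Coefficients (c12 c13 c22 c23 c33 : Carrier) where

      open Index O using (c'12; c'13; c'33; MaxMin<)
      open import Algebra.Solver.CommutativeMonoid commutativeMonoid using (solve; _⊜_; _⊕_) renaming (id to ε′)

      index : (m12 m13 m22 m23 m33 : ℕ) → Carrier
      index m12 m13 m22 m23 m33 = (m12 · c12) ∙ ((m13 · c13) ∙ ((m22 · c22) ∙ ((m23 · c23) ∙ (m33 · c33))))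

      excess : (m12 m13 m33 : ℕ) → Carrier
      excess m12 m13 m33 = (m12 · c'12 c12 c22 c23) ∙ ((m13 · c'13 c13 c22 c23) ∙ (m33 · c'33 c22 c23 c33))

      scaled : ∀ m {x a y z} → x ∙ a · y ≈ z → m · x ∙ (m * a) · y ≈ m · z
      scaled m {x} {a} {y} x∙ay≈z = ≈-trans (≈-sym (·-distrib-∙· m x a y)) (·-congʳ m x∙ay≈z)

      -- The multiples are natural numbers, so instead of subtracting, (4m₁₂ + 3m₁₃) c₂₂ + 2m₃₃ c₂₃
      -- is added to both sides and cancelled afterwards.
      index-decomposition : ∀ n m12 m13 m22 m23 m33 →
        m22 + (m12 * 4 + m13 * 3) ≡ n + m33 → m23 + m33 * 2 ≡ m12 * 3 + m13 * 2 →
        index m12 m13 m22 m23 m33 ≈ n · c22 ∙ excess m12 m13 m33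
      index-decomposition n m12 m13 m22 m23 m33 e₂₂ e₂₃ =
        ∙-cancelʳ (P ∙ Q) (index m12 m13 m22 m23 m33) (n · c22 ∙ excess m12 m13 m33) (≈-trans lhs (≈-sym rhs))
        where
        open import Relation.Binary.Reasoning.Setoid setoid
        A = m12 · c12
        B = m13 · c13
        E = m33 · c33
        P = (m12 * 4 + m13 * 3) · c22
        Q = (m33 * 2) · c23
        common = A ∙ (B ∙ ((n · c22 ∙ m33 · c22) ∙ (((m12 * 3) · c23 ∙ (m13 * 2) · c23) ∙ E)))
        lhs : index m12 m13 m22 m23 m33 ∙ (P ∙ Q) ≈ common
        lhs = begin
          index m12 m13 m22 m23 m33 ∙ (P ∙ Q)
            ≈⟨ solve 7 (λ a b c d e p q → (a ⊕ (b ⊕ (c ⊕ (d ⊕ e)))) ⊕ (p ⊕ q) ⊜ a ⊕ (b ⊕ ((c ⊕ p) ⊕ ((d ⊕ q) ⊕ e))))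
                     ≈-refl A B (m22 · c22) (m23 · c23) E P Q ⟩
          A ∙ (B ∙ ((m22 · c22 ∙ P) ∙ ((m23 · c23 ∙ Q) ∙ E)))
            ≈⟨ ∙-congˡ (∙-congˡ (∙-cong (≈-sym (·-homo-+ m22 (m12 * 4 + m13 * 3) c22))
                                        (∙-congʳ (≈-sym (·-homo-+ m23 (m33 * 2) c23))))) ⟩
          A ∙ (B ∙ ((m22 + (m12 * 4 + m13 * 3)) · c22 ∙ ((m23 + m33 * 2) · c23 ∙ E)))
            ≈⟨ ∙-congˡ (∙-congˡ (∙-cong (reflexive (cong (_· c22) e₂₂)) (∙-congʳ (reflexive (cong (_· c23) e₂₃))))) ⟩
          A ∙ (B ∙ ((n + m33) · c22 ∙ ((m12 * 3 + m13 * 2) · c23 ∙ E)))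
            ≈⟨ ∙-congˡ (∙-congˡ (∙-cong (·-homo-+ n m33 c22) (∙-congʳ (·-homo-+ (m12 * 3) (m13 * 2) c23)))) ⟩
          common ∎
        rhs : (n · c22 ∙ excess m12 m13 m33) ∙ (P ∙ Q) ≈ common
        rhs = begin
          (n · c22 ∙ excess m12 m13 m33) ∙ (P ∙ Q)
            ≈⟨ ∙-congˡ (∙-congʳ (·-homo-+ (m12 * 4) (m13 * 3) c22)) ⟩
          (n · c22 ∙ excess m12 m13 m33) ∙ (((m12 * 4) · c22 ∙ (m13 * 3) · c22) ∙ Q)
            ≈⟨ solve 7 (λ x y z w p q r → (x ⊕ (y ⊕ (z ⊕ w))) ⊕ ((p ⊕ q) ⊕ r) ⊜ x ⊕ ((y ⊕ p) ⊕ ((z ⊕ q) ⊕ (w ⊕ r))))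
                     ≈-refl (n · c22) (m12 · c'12 c12 c22 c23) (m13 · c'13 c13 c22 c23) (m33 · c'33 c22 c23 c33)
                     ((m12 * 4) · c22) ((m13 * 3) · c22) Q ⟩
          n · c22 ∙ ((m12 · c'12 c12 c22 c23 ∙ (m12 * 4) · c22) ∙ ((m13 · c'13 c13 c22 c23 ∙ (m13 * 3) · c22)
                                                                ∙ (m33 · c'33 c22 c23 c33 ∙ Q)))
            ≈⟨ ∙-congˡ (∙-cong (scaled m12 (//-rightDividesˡ (4 · c22) (c12 ∙ 3 · c23)))
                       (∙-cong (scaled m13 (//-rightDividesˡ (3 · c22) (c13 ∙ 2 · c23)))
                               (scaled m33 (//-rightDividesˡ (2 · c23) (c22 ∙ c33))))) ⟩
          n · c22 ∙ (m12 · (c12 ∙ 3 · c23) ∙ (m13 · (c13 ∙ 2 · c23) ∙ m33 · (c22 ∙ c33)))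
            ≈⟨ ∙-congˡ (∙-cong (·-distrib-∙· m12 c12 3 c23) (∙-cong (·-distrib-∙· m13 c13 2 c23) (·-distrib-∙ m33 c22 c33))) ⟩
          n · c22 ∙ ((A ∙ (m12 * 3) · c23) ∙ ((B ∙ (m13 * 2) · c23) ∙ (m33 · c22 ∙ E)))
            ≈⟨ solve 7 (λ x a p b q d e → x ⊕ ((a ⊕ p) ⊕ ((b ⊕ q) ⊕ (d ⊕ e))) ⊜ a ⊕ (b ⊕ ((x ⊕ d) ⊕ ((p ⊕ q) ⊕ e))))
                     ≈-refl (n · c22) A ((m12 * 3) · c23) B ((m13 * 2) · c23) (m33 · c22) E ⟩
          common ∎

      module _ (hyp : MaxMin< (c'33 c22 c23 c33) (c'12 c12 c22 c23) (c'13 c13 c22 c23)) where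

        private
          a = c'12 c12 c22 c23
          b = c'13 c13 c22 c23
          d = c'33 c22 c23 c33
          ε<a : ε <ᵍ a
          ε<a = proj₁ hyp
          ε<b : ε <ᵍ b
          ε<b = proj₁ (proj₂ hyp)
          ε<a∙d : ε <ᵍ a ∙ d
          ε<a∙d = ε<x∙y (proj₁ (proj₂ (proj₂ hyp)))
          ε<b∙d : ε <ᵍ b ∙ d
          ε<b∙d = ε<x∙y (proj₂ (proj₂ (proj₂ hyp)))
          ε≤m13·b∙ε : ∀ m13 → ε ≤ᵍ m13 · b ∙ ε
          ε≤m13·b∙ε m13 = ε≤∙ (ε≤· m13 (<ᵍ⇒≤ᵍ ε<b)) (inj₂ ≈-refl)

        peel-a : ∀ i m13 j → excess (suc i) m13 (suc j) ≈ (a ∙ d) ∙ excess i m13 j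
        peel-a i m13 j = solve 5 (λ x i′ y z j′ → (x ⊕ i′) ⊕ (y ⊕ (z ⊕ j′)) ⊜ (x ⊕ z) ⊕ (i′ ⊕ (y ⊕ j′)))
                               ≈-refl a (i · a) (m13 · b) d (j · d)

        peel-b : ∀ i j → excess 0 (suc i) (suc j) ≈ (b ∙ d) ∙ excess 0 i j
        peel-b i j = solve 4 (λ y i′ z j′ → ε′ ⊕ ((y ⊕ i′) ⊕ (z ⊕ j′)) ⊜ (y ⊕ z) ⊕ (ε′ ⊕ (i′ ⊕ j′)))
                           ≈-refl b (i · b) d (j · d)

        -- Each copy of c′₃₃ is paired with a copy of c′₁₂ or c′₁₃; every such pair is positive.
        excess-nonneg : ∀ m12 m13 m33 → m33 ≤ m12 + m13 → ε ≤ᵍ excess m12 m13 m33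
        excess-pos    : ∀ m12 m13 m33 → m33 ≤ m12 + m13 → 0 < m12 + m13 → ε <ᵍ excess m12 m13 m33

        excess-nonneg m12 m13 zero    _ = ε≤∙ (ε≤· m12 (<ᵍ⇒≤ᵍ ε<a)) (ε≤m13·b∙ε m13)
        excess-nonneg m12 m13 (suc j) h = <ᵍ⇒≤ᵍ (excess-pos m12 m13 (suc j) h (≤-trans (s≤s z≤n) h))

        excess-pos (suc i) m13     (suc j) (s≤s h) _ = <-respʳ-≈ (≈-sym (peel-a i m13 j)) (ε<∙ ε<a∙d (excess-nonneg i m13 j h))
        excess-pos zero    (suc i) (suc j) (s≤s h) _ = <-respʳ-≈ (≈-sym (peel-b i j)) (ε<∙ ε<b∙d (excess-nonneg 0 i j h))
        excess-pos (suc i) m13     zero    _ _ = ε<∙ (ε<· i ε<a) (ε≤m13·b∙ε m13)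
        excess-pos zero    (suc i) zero    _ _ = <-respʳ-≈ (≈-sym (identityˡ _)) (ε<∙ (ε<· i ε<b) (inj₂ ≈-refl))

        index-increase : ∀ {n p12 p13 p22 p23 p33 m12 m13 m22 m23 m33} →
          UnicyclicCounts n p12 p13 p22 p23 p33 → p12 ≡ 0 → p13 ≡ 0 → p33 ≡ 0 →
          UnicyclicCounts n m12 m13 m22 m23 m33 → 0 < m12 + m13 →
          index p12 p13 p22 p23 p33 <ᵍ index m12 m13 m22 m23 m33
        index-increase {n} {_} {_} {p22} {p23} {_} {m12} {m13} {m22} {m23} {m33} P refl refl refl M 0<m₁₂+m₁₃ =
          <-respˡ-≈ (≈-sym index-P≈) (<-respʳ-≈ (≈-sym index-M≈) (<-respˡ-≈ (identityʳ (n · c22)) (∙-monoʳ-< (n · c22) ε<excess)))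
          where
          open UnicyclicCounts
          index-P≈ : index 0 0 p22 p23 0 ≈ n · c22
          index-P≈ = ≈-trans (index-decomposition n 0 0 p22 p23 0 (m₂₂-relation P) (m₂₃-relation P))
                             (≈-trans (∙-congˡ (≈-trans (identityˡ _) (identityˡ _))) (identityʳ _))
          index-M≈ : index m12 m13 m22 m23 m33 ≈ n · c22 ∙ excess m12 m13 m33
          index-M≈ = index-decomposition n m12 m13 m22 m23 m33 (m₂₂-relation M) (m₂₃-relation M)
          ε<excess : ε <ᵍ excess m12 m13 m33
          ε<excess = excess-pos m12 m13 m33 (m₃₃≤m₁₂+m₁₃ M) 0<m₁₂+m₁₃

theorem2 : ∀ {c ℓ₁ ℓ₂ : Level} (O : OrderedAbelianGroup c ℓ₁ ℓ₂) →
    let open OrderedAbelianGroup O in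
    let open Index O in
    (k : ℕ) (c12 c13 c22 c23 c33 : Carrier) →
    MaxMin< (c'33 c22 c23 c33) (c'12 c12 c22 c23) (c'13 c13 c22 c23) →
    𝒢₃ (3 + k) (3 + k) (cycle k) ×
    ((G : Graph (3 + k)) → 𝒢₃ (3 + k) (3 + k) G → ¬ (G ≅ cycle k) →
      I c12 c13 c22 c23 c33 (cycle k) < I c12 c13 c22 c23 c33 G)
theorem2 O k c12 c13 c22 c23 c33 hyp = C-∈-𝒢₃ , cycle-below
  where
  open Chemical-Graphs
  open Cycle k using (C-∈-𝒢₃; C-m≡0)
  open Ordered-Group.Coefficients O c12 c13 c22 c23 c33 using (index-increase)
  open Unicyclic-Chemical-Graph k (cycle k) C-∈-𝒢₃ using () renaming (counts to cycle-counts)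
  cycle-below = λ G G∈𝒢₃ G≇C →
    let open Unicyclic-Chemical-Graph k G G∈𝒢₃ using (counts; ≇cycle⇒pendant) in
    index-increase hyp cycle-counts (C-m≡0 1 2 refl) (C-m≡0 1 3 refl) (C-m≡0 3 3 refl) counts (≇cycle⇒pendant G≇C)
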